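{- For every integer $m>0$ and every integer $n\ge0$, $$\sum_{k=0}^n\begin{bmatrix}n\\ k\end{bmatrix}q^{\binom{k}{2}}[m+2k]_q\frac{[m+k-1]_q!}{[m+n+k]_q!}=\frac{(-1;q)_n}{[m+1]_q[m+3]_q\cdots[m+2n-1]_q}.$$
   Context: $q$ is an indeterminate; $[n]_q=\frac{1-q^n}{1-q}$, $[n]_q!=[1]_q\cdots[n]_q$, $[0]_q!=1$; $\begin{bmatrix}n\\k\end{bmatrix}=\frac{[n]_q!}{[k]_q![n-k]_q!}$; $(a;q)_n=(1-a)(1-qa)\cdots(1-q^{n-1}a)$, $(a;q)_0=1$; for $n=0$ the empty product in the denominator is $1$. -}

module Defs where

open import Data.Nat using (ℕ; zero; suc; _∸_) renaming (_+_ to _+ℕ_; _*_ to _*ℕ_)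
open import Data.Integer using (ℤ; +_; -_) renaming (_+_ to _+ℤ_; _*_ to _*ℤ_)
open import Data.List using (List; []; _∷_; map; replicate; _++_)
open import Data.List.Relation.Unary.All using (All)
open import Relation.Binary.PropositionalEquality using (_≡_)

-- Polynomials in the indeterminate q with integer coefficients,
-- represented as coefficient lists (constant term first).

Poly : Set
Poly = List ℤ

_+P_ : Poly → Poly → Poly
[]      +P p'       = p'
(a ∷ p) +P []       = a ∷ p
(a ∷ p) +P (b ∷ p') = (a +ℤ b) ∷ (p +P p')

scaleP : ℤ → Poly → Poly
scaleP a = map (a *ℤ_)

_*P_ : Poly → Poly → Poly
[]      *P p' = []
(a ∷ p) *P p' = scaleP a p' +P ((+ 0) ∷ (p *P p'))

negP : Poly → Poly
negP = map -_

_-P_ : Poly → Poly → Poly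
p -P p' = p +P negP p'

_≈P_ : Poly → Poly → Set
p ≈P p' = All (_≡ + 0) (p -P p')

constP : ℤ → Poly
constP a = a ∷ []

oneP : Poly
oneP = constP (+ 1)

qPow : ℕ → Poly
qPow e = replicate e (+ 0) ++ (+ 1 ∷ [])

-- Rational functions in q (field of fractions Q(q), elements of
-- which are represented by formal fractions num/den).

record Frac : Set where
  constructor _//_
  field
    num : Poly
    den : Poly
open Frac public

_≃F_ : Frac → Frac → Set
x ≃F y = (num x *P den y) ≈P (num y *P den x)

_+F_ : Frac → Frac → Frac
x +F y = ((num x *P den y) +P (num y *P den x)) // (den x *P den y)

_*F_ : Frac → Frac → Frac
x *F y = (num x *P num y) // (den x *P den y)

_/F_ : Frac → Frac → Frac
x /F y = (num x *P den y) // (den x *P num y)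

polyF : Poly → Frac
polyF p = p // oneP

oneF : Frac
oneF = polyF oneP

qInt : ℕ → Frac
qInt n = (oneP -P qPow n) // (oneP -P qPow 1)

qFact : ℕ → Frac
qFact zero    = oneF
qFact (suc n) = qFact n *F qInt (suc n)

qBinom : ℕ → ℕ → Frac
qBinom n k = qFact n /F (qFact k *F qFact (n ∸ k))

qPoch : Poly → ℕ → Frac
qPoch a zero    = oneF
qPoch a (suc n) = qPoch a n *F polyF (oneP -P (qPow n *P a))

sumF : ℕ → (ℕ → Frac) → Frac
sumF zero    f = f zero
sumF (suc n) f = sumF n f +F f (suc n)

oddProd : ℕ → ℕ → Frac
oddProd m zero    = oneF
oddProd m (suc n) = oddProd m n *F qInt (m +ℕ 1 +ℕ 2 *ℕ n)

-- Write m = suc M and clear denominators: the k-th summand times [m][m+1]⋯[m+2n] is a polynomial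
-- T n k, and the right-hand side times the same product is (-1;q)ₙ [m][m+2]⋯[m+2n].  So it
-- suffices that the row sums S n = Σₖ T n k satisfy S (n+1) = (1+qⁿ)[m+2n+2] S n, which follows by
-- telescoping from the WZ relation
--   [m+2n+1] T (n+1) k = (1+qⁿ)[m+2n+1][m+2n+2] T n k + U n (k-1) - U n k
-- with an explicit certificate U.  Dividing out the factor common to its four terms, the relation
-- reduces, by q-Pascal and [k+j+1 choose k-1][j+1] = [k+j choose k][k], to two identities between
-- q-integers with linear exponents, checked by expanding [s+t] = [s] + qˢ[t] and qˢ = 1 - (1-q)[s]
-- and normalising with the ring solver.  Integer polynomials form an integral domain, so non-zero
-- factors cancel and fractions can be compared by cross-multiplication.

module Submission where

open import Defs
open import Data.Nat using (ℕ; _+_; _*_; _∸_; _<_)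
open import Data.Nat.Combinatorics using (_C_)
open import Data.Integer using (-[1+_])

open import Algebra.Structures using (IsCommutativeMonoid)
open import Algebra.Structures.Biased using (IsCommutativeSemiringˡ)
open import Data.Empty using (⊥-elim)
open import Data.Fin as Fin using (Fin)
open import Data.Integer using (ℤ; +_) renaming (_+_ to _+ℤ_; _*_ to _*ℤ_; -_ to -ℤ_)
import Data.Integer.Properties as ℤ
import Data.Integer.Tactic.RingSolver as ℤ-Solver
open import Data.List using ([]; _∷_)
open import Data.List.Relation.Unary.All using (All; []; _∷_)
open import Data.Maybe using (Maybe; just; nothing)
open import Data.Nat using (zero; suc; _≤_; z≤n; s≤s)
import Data.Nat.Combinatorics as C
import Data.Nat.Properties as ℕ
import Data.Nat.Tactic.RingSolver as ℕ-Solver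
open import Data.Product using (_×_; _,_; proj₁; proj₂)
open import Data.Sum using (_⊎_; inj₁; inj₂; [_,_])
import Data.Sum as Sum
open import Data.Vec as Vec using (Vec; []; _∷_)
open import Data.Vec.N-ary using (N-ary)
import Data.Vec.Properties as Vec
open import Data.Vec.Relation.Binary.Pointwise.Inductive as Pointwise using (Pointwise; []; _∷_)
open import Function using (_∘_)
open import Relation.Binary.Bundles using (Setoid)
open import Relation.Binary.PropositionalEquality using (_≡_; refl; sym; trans; cong; cong₂; subst; subst₂; module ≡-Reasoning)
import Relation.Binary.Reasoning.Setoid as SetoidReasoning
open import Relation.Binary.Structures using (IsEquivalence)
open import Relation.Nullary using (¬_)
open import Tactic.RingSolver using (solve-∀)
open import Tactic.RingSolver.Core.AlmostCommutativeRing using (AlmostCommutativeRing)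

-- Integer polynomials as a commutative ring

coeff : Poly → ℕ → ℤ
coeff []      _       = + 0
coeff (a ∷ p) zero    = a
coeff (a ∷ p) (suc i) = coeff p i

infix 4 _≅_
record _≅_ (p r : Poly) : Set where
  constructor coeffwise
  field coeff-≡ : ∀ i → coeff p i ≡ coeff r i
open _≅_

≅-refl : ∀ {p} → p ≅ p
≅-refl = coeffwise λ _ → refl

≅-sym : ∀ {p r} → p ≅ r → r ≅ p
≅-sym e = coeffwise λ i → sym (coeff-≡ e i)

≅-trans : ∀ {p r s} → p ≅ r → r ≅ s → p ≅ s
≅-trans e f = coeffwise λ i → trans (coeff-≡ e i) (coeff-≡ f i)

≅-isEquivalence : IsEquivalence _≅_
≅-isEquivalence = record { refl = ≅-refl ; sym = ≅-sym ; trans = ≅-trans }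

≅-setoid : Setoid _ _
≅-setoid = record { isEquivalence = ≅-isEquivalence }

module ≅-Reasoning = SetoidReasoning ≅-setoid

≡⇒≅ : ∀ {p r} → p ≡ r → p ≅ r
≡⇒≅ refl = ≅-refl

∷-cong : ∀ {a b p r} → a ≡ b → p ≅ r → a ∷ p ≅ b ∷ r
∷-cong a≡b p≅r = coeffwise λ { zero → a≡b ; (suc i) → coeff-≡ p≅r i }

∷-≅[] : ∀ {a p} → a ≡ + 0 → p ≅ [] → a ∷ p ≅ []
∷-≅[] a≡0 p≅[] = coeffwise λ { zero → a≡0 ; (suc i) → coeff-≡ p≅[] i }

∷-injective : ∀ {a b p r} → a ∷ p ≅ b ∷ r → p ≅ r
∷-injective e = coeffwise λ i → coeff-≡ e (suc i)

coeff-+ : ∀ p r i → coeff (p +P r) i ≡ coeff p i +ℤ coeff r i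
coeff-+ []      r       i       = sym (ℤ.+-identityˡ _)
coeff-+ (a ∷ p) []      i       = sym (ℤ.+-identityʳ _)
coeff-+ (a ∷ p) (b ∷ r) zero    = refl
coeff-+ (a ∷ p) (b ∷ r) (suc i) = coeff-+ p r i

coeff-scale : ∀ a p i → coeff (scaleP a p) i ≡ a *ℤ coeff p i
coeff-scale a []      i       = sym (ℤ.*-zeroʳ a)
coeff-scale a (b ∷ p) zero    = refl
coeff-scale a (b ∷ p) (suc i) = coeff-scale a p i

coeff-neg : ∀ p i → coeff (negP p) i ≡ -ℤ coeff p i
coeff-neg []      i       = refl
coeff-neg (b ∷ p) zero    = refl
coeff-neg (b ∷ p) (suc i) = coeff-neg p i

+P-cong : ∀ {p p' r r'} → p ≅ p' → r ≅ r' → p +P r ≅ p' +P r'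
+P-cong {p} {p'} {r} {r'} e f = coeffwise λ i →
  trans (coeff-+ p r i) (trans (cong₂ _+ℤ_ (coeff-≡ e i) (coeff-≡ f i)) (sym (coeff-+ p' r' i)))

+P-congˡ : ∀ {p p'} r → p ≅ p' → (p +P r) ≅ (p' +P r)
+P-congˡ r e = +P-cong e (≅-refl {r})

+P-congʳ : ∀ p {r r'} → r ≅ r' → (p +P r) ≅ (p +P r')
+P-congʳ p e = +P-cong (≅-refl {p}) e

+P-comm : ∀ p r → p +P r ≅ r +P p
+P-comm p r = coeffwise λ i → trans (coeff-+ p r i) (trans (ℤ.+-comm (coeff p i) _) (sym (coeff-+ r p i)))

+P-assoc : ∀ p r s → (p +P r) +P s ≅ p +P (r +P s)
+P-assoc p r s = coeffwise λ i → begin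
  coeff ((p +P r) +P s) i             ≡⟨ trans (coeff-+ (p +P r) s i) (cong (_+ℤ coeff s i) (coeff-+ p r i)) ⟩
  coeff p i +ℤ coeff r i +ℤ coeff s i   ≡⟨ ℤ.+-assoc (coeff p i) _ _ ⟩
  coeff p i +ℤ (coeff r i +ℤ coeff s i) ≡⟨ sym (trans (coeff-+ p (r +P s) i) (cong (coeff p i +ℤ_) (coeff-+ r s i))) ⟩
  coeff (p +P (r +P s)) i             ∎
  where open ≡-Reasoning

+P-identityʳ : ∀ p → p +P [] ≅ p
+P-identityʳ p = coeffwise λ i → trans (coeff-+ p [] i) (ℤ.+-identityʳ _)

negP-cong : ∀ {p p'} → p ≅ p' → negP p ≅ negP p'
negP-cong {p} {p'} e = coeffwise λ i → trans (coeff-neg p i) (trans (cong -ℤ_ (coeff-≡ e i)) (sym (coeff-neg p' i)))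

negP-+P : ∀ p r → negP p +P negP r ≅ negP (p +P r)
negP-+P p r = coeffwise λ i → begin
  coeff (negP p +P negP r) i          ≡⟨ trans (coeff-+ (negP p) (negP r) i) (cong₂ _+ℤ_ (coeff-neg p i) (coeff-neg r i)) ⟩
  -ℤ coeff p i +ℤ -ℤ coeff r i     ≡⟨ sym (ℤ.neg-distrib-+ (coeff p i) _) ⟩
  -ℤ (coeff p i +ℤ coeff r i)       ≡⟨ sym (trans (coeff-neg (p +P r) i) (cong -ℤ_ (coeff-+ p r i))) ⟩
  coeff (negP (p +P r)) i             ∎
  where open ≡-Reasoning

+P-inverseʳ : ∀ p → p +P negP p ≅ []
+P-inverseʳ p = coeffwise λ i →
  trans (coeff-+ p (negP p) i) (trans (cong (coeff p i +ℤ_) (coeff-neg p i)) (ℤ.+-inverseʳ (coeff p i)))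

coeff-∷*P : ∀ a p r i → coeff ((a ∷ p) *P r) i ≡ a *ℤ coeff r i +ℤ coeff (+ 0 ∷ (p *P r)) i
coeff-∷*P a p r i = trans (coeff-+ (scaleP a r) (+ 0 ∷ (p *P r)) i) (cong (_+ℤ _) (coeff-scale a r i))

*P-zeroʳ : ∀ p → p *P [] ≅ []
*P-zeroʳ []      = ≅-refl
*P-zeroʳ (a ∷ p) = ∷-≅[] refl (*P-zeroʳ p)

*P-zeroˡ : ∀ {p} r → p ≅ [] → p *P r ≅ []
*P-zeroˡ {[]}    r e = ≅-refl
*P-zeroˡ {a ∷ p} r e = coeffwise λ i → begin
  coeff ((a ∷ p) *P r) i                      ≡⟨ coeff-∷*P a p r i ⟩
  a *ℤ coeff r i +ℤ coeff (+ 0 ∷ (p *P r)) i  ≡⟨ cong₂ _+ℤ_ (cong (_*ℤ coeff r i) (coeff-≡ e zero))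
                                                   (coeff-≡ (∷-≅[] refl (*P-zeroˡ {p} r (coeffwise λ j → coeff-≡ e (suc j)))) i) ⟩
  + 0 *ℤ coeff r i +ℤ + 0                     ≡⟨ ℤ.+-identityʳ _ ⟩
  + 0 *ℤ coeff r i                            ≡⟨ ℤ.*-zeroˡ (coeff r i) ⟩
  + 0                                         ∎
  where open ≡-Reasoning

scaleP-+P : ∀ a x y → scaleP a x +P scaleP a y ≅ scaleP a (x +P y)
scaleP-+P a x y = coeffwise λ i → begin
  coeff (scaleP a x +P scaleP a y) i    ≡⟨ trans (coeff-+ (scaleP a x) _ i) (cong₂ _+ℤ_ (coeff-scale a x i) (coeff-scale a y i)) ⟩
  a *ℤ coeff x i +ℤ a *ℤ coeff y i      ≡⟨ sym (ℤ.*-distribˡ-+ a (coeff x i) _) ⟩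
  a *ℤ (coeff x i +ℤ coeff y i)         ≡⟨ sym (trans (coeff-scale a (x +P y) i) (cong (a *ℤ_) (coeff-+ x y i))) ⟩
  coeff (scaleP a (x +P y)) i           ∎
  where open ≡-Reasoning

scaleP-scaleP : ∀ a b x → scaleP (a *ℤ b) x ≅ scaleP a (scaleP b x)
scaleP-scaleP a b x = coeffwise λ i → begin
  coeff (scaleP (a *ℤ b) x) i   ≡⟨ coeff-scale (a *ℤ b) x i ⟩
  a *ℤ b *ℤ coeff x i           ≡⟨ ℤ.*-assoc a b _ ⟩
  a *ℤ (b *ℤ coeff x i)         ≡⟨ sym (trans (coeff-scale a (scaleP b x) i) (cong (a *ℤ_) (coeff-scale b x i))) ⟩
  coeff (scaleP a (scaleP b x)) i ∎
  where open ≡-Reasoning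

scaleP-distrib-+ℤ : ∀ a b x → scaleP (a +ℤ b) x ≅ scaleP a x +P scaleP b x
scaleP-distrib-+ℤ a b x = coeffwise λ i → begin
  coeff (scaleP (a +ℤ b) x) i        ≡⟨ coeff-scale (a +ℤ b) x i ⟩
  (a +ℤ b) *ℤ coeff x i              ≡⟨ ℤ.*-distribʳ-+ (coeff x i) a b ⟩
  a *ℤ coeff x i +ℤ b *ℤ coeff x i   ≡⟨ sym (trans (coeff-+ (scaleP a x) _ i) (cong₂ _+ℤ_ (coeff-scale a x i) (coeff-scale b x i))) ⟩
  coeff (scaleP a x +P scaleP b x) i ∎
  where open ≡-Reasoning

scaleP-∷ : ∀ a y → + 0 ∷ scaleP a y ≅ scaleP a (+ 0 ∷ y)
scaleP-∷ a y = ∷-cong (sym (ℤ.*-zeroʳ a)) ≅-refl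

+P-interchange : ∀ w x y z → (w +P x) +P (y +P z) ≅ (w +P y) +P (x +P z)
+P-interchange w x y z = coeffwise λ i → begin
  coeff ((w +P x) +P (y +P z)) i              ≡⟨ expand w x y z i ⟩
  (coeff w i +ℤ coeff x i) +ℤ (coeff y i +ℤ coeff z i) ≡⟨ swap (coeff w i) _ _ _ ⟩
  (coeff w i +ℤ coeff y i) +ℤ (coeff x i +ℤ coeff z i) ≡⟨ sym (expand w y x z i) ⟩
  coeff ((w +P y) +P (x +P z)) i              ∎
  where
  open ≡-Reasoning
  expand : ∀ w x y z i → coeff ((w +P x) +P (y +P z)) i ≡ (coeff w i +ℤ coeff x i) +ℤ (coeff y i +ℤ coeff z i)
  expand w x y z i = trans (coeff-+ (w +P x) _ i) (cong₂ _+ℤ_ (coeff-+ w x i) (coeff-+ y z i))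
  swap : ∀ a b c d → (a +ℤ b) +ℤ (c +ℤ d) ≡ (a +ℤ c) +ℤ (b +ℤ d)
  swap = ℤ-Solver.solve-∀

*P-congˡ : ∀ {p p'} r → p ≅ p' → p *P r ≅ p' *P r
*P-congˡ {[]}    {[]}     r e = ≅-refl
*P-congˡ {[]}    {b ∷ p'} r e = ≅-sym (*P-zeroˡ r (≅-sym e))
*P-congˡ {a ∷ p} {[]}     r e = *P-zeroˡ r e
*P-congˡ {a ∷ p} {b ∷ p'} r e =
  +P-cong (≡⇒≅ (cong (λ c → scaleP c r) (coeff-≡ e zero))) (∷-cong refl (*P-congˡ r (∷-injective e)))

*P-distribʳ : ∀ r p p' → (p +P p') *P r ≅ (p *P r) +P (p' *P r)
*P-distribʳ r []      p'       = ≅-refl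
*P-distribʳ r (a ∷ p) []       = ≅-sym (+P-identityʳ _)
*P-distribʳ r (a ∷ p) (b ∷ p') = begin
  scaleP (a +ℤ b) r +P (+ 0 ∷ ((p +P p') *P r))
    ≈⟨ +P-cong (scaleP-distrib-+ℤ a b r) (∷-cong refl (*P-distribʳ r p p')) ⟩
  (scaleP a r +P scaleP b r) +P ((+ 0 ∷ (p *P r)) +P (+ 0 ∷ (p' *P r)))
    ≈⟨ +P-interchange (scaleP a r) _ _ _ ⟩
  ((a ∷ p) *P r) +P ((b ∷ p') *P r) ∎
  where open ≅-Reasoning

scaleP-*P : ∀ a u s → scaleP a u *P s ≅ scaleP a (u *P s)
scaleP-*P a []      s = ≅-refl
scaleP-*P a (b ∷ u) s = begin
  scaleP (a *ℤ b) s +P (+ 0 ∷ (scaleP a u *P s))    ≈⟨ +P-cong (scaleP-scaleP a b s) (∷-cong refl (scaleP-*P a u s)) ⟩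
  scaleP a (scaleP b s) +P (+ 0 ∷ scaleP a (u *P s)) ≈⟨ +P-congʳ (scaleP a (scaleP b s)) (scaleP-∷ a (u *P s)) ⟩
  scaleP a (scaleP b s) +P scaleP a (+ 0 ∷ (u *P s)) ≈⟨ scaleP-+P a (scaleP b s) (+ 0 ∷ (u *P s)) ⟩
  scaleP a ((b ∷ u) *P s)                           ∎
  where open ≅-Reasoning

*P-assoc : ∀ p r s → (p *P r) *P s ≅ p *P (r *P s)
*P-assoc []      r s = ≅-refl
*P-assoc (a ∷ p) r s = begin
  (scaleP a r +P (+ 0 ∷ (p *P r))) *P s ≈⟨ *P-distribʳ s (scaleP a r) _ ⟩
  (scaleP a r *P s) +P ((+ 0 ∷ (p *P r)) *P s) ≈⟨ +P-cong (scaleP-*P a r s) (shift (p *P r)) ⟩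
  scaleP a (r *P s) +P (+ 0 ∷ ((p *P r) *P s)) ≈⟨ +P-congʳ (scaleP a (r *P s)) (∷-cong refl (*P-assoc p r s)) ⟩
  (a ∷ p) *P (r *P s)                           ∎
  where
  open ≅-Reasoning
  shift : ∀ x → (+ 0 ∷ x) *P s ≅ + 0 ∷ (x *P s)
  shift x = coeffwise λ i → trans (coeff-∷*P (+ 0) x s i) (trans (cong (_+ℤ coeff (+ 0 ∷ (x *P s)) i) (ℤ.*-zeroˡ (coeff s i))) (ℤ.+-identityˡ _))

*P-∷ʳ : ∀ p b r → p *P (b ∷ r) ≅ scaleP b p +P (+ 0 ∷ (p *P r))
*P-∷ʳ []      b r = ≅-sym (∷-≅[] refl ≅-refl)
*P-∷ʳ (a ∷ p) b r = ∷-cong (trans (ℤ.+-identityʳ _) (trans (ℤ.*-comm a b) (sym (ℤ.+-identityʳ _)))) (begin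
  scaleP a r +P (p *P (b ∷ r)) ≈⟨ +P-congʳ (scaleP a r) (*P-∷ʳ p b r) ⟩
  scaleP a r +P (scaleP b p +P (+ 0 ∷ (p *P r))) ≈⟨ swap (scaleP a r) (scaleP b p) (+ 0 ∷ (p *P r)) ⟩
  scaleP b p +P (scaleP a r +P (+ 0 ∷ (p *P r))) ∎)
  where
  open ≅-Reasoning
  swap : ∀ x y z → x +P (y +P z) ≅ y +P (x +P z)
  swap x y z = ≅-trans (≅-sym (+P-assoc x y z)) (≅-trans (+P-congˡ z (+P-comm x y)) (+P-assoc y x z))

*P-comm : ∀ p r → p *P r ≅ r *P p
*P-comm []      r = ≅-sym (*P-zeroʳ r)
*P-comm (a ∷ p) r = begin
  scaleP a r +P (+ 0 ∷ (p *P r)) ≈⟨ +P-congʳ (scaleP a r) (∷-cong refl (*P-comm p r)) ⟩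
  scaleP a r +P (+ 0 ∷ (r *P p)) ≈⟨ ≅-sym (*P-∷ʳ r a p) ⟩
  r *P (a ∷ p)                  ∎
  where open ≅-Reasoning

*P-cong : ∀ {p p' r r'} → p ≅ p' → r ≅ r' → p *P r ≅ p' *P r'
*P-cong {p} {p'} {r} {r'} e f =
  ≅-trans (*P-congˡ r e) (≅-trans (*P-comm p' r) (≅-trans (*P-congˡ p' f) (*P-comm r' p')))

*P-congʳ : ∀ p {r r'} → r ≅ r' → (p *P r) ≅ (p *P r')
*P-congʳ p {r} {r'} e = ≅-trans (*P-comm p r) (≅-trans (*P-congˡ p e) (*P-comm r' p))

*P-identityˡ : ∀ p → (oneP *P p) ≅ p
*P-identityˡ p = coeffwise λ i →
  trans (coeff-∷*P (+ 1) [] p i) (trans (cong₂ _+ℤ_ (ℤ.*-identityˡ (coeff p i)) (zero-coeff i)) (ℤ.+-identityʳ _))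
  where
  zero-coeff : ∀ i → coeff (+ 0 ∷ []) i ≡ + 0
  zero-coeff zero    = refl
  zero-coeff (suc i) = refl

*P-identityʳ : ∀ p → (p *P oneP) ≅ p
*P-identityʳ p = ≅-trans (*P-comm p oneP) (*P-identityˡ p)

negP-*P : ∀ p r → negP p *P r ≅ negP (p *P r)
negP-*P p r = begin
  negP p *P r ≈⟨ *P-congˡ r (neg≅scale p) ⟩
  scaleP -[1+ 0 ] p *P r  ≈⟨ scaleP-*P -[1+ 0 ] p r ⟩
  scaleP -[1+ 0 ] (p *P r) ≈⟨ ≅-sym (neg≅scale (p *P r)) ⟩
  negP (p *P r)           ∎
  where
  open ≅-Reasoning
  neg≅scale : ∀ x → negP x ≅ scaleP -[1+ 0 ] x
  neg≅scale x = coeffwise λ i → trans (coeff-neg x i) (trans (sym (ℤ.-1*i≡-i (coeff x i))) (sym (coeff-scale -[1+ 0 ] x i)))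

≅[]? : ∀ p → Maybe ([] ≅ p)
≅[]? []           = just ≅-refl
≅[]? (+ zero ∷ p) with ≅[]? p
... | just []≅p   = just (≅-sym (∷-≅[] refl (≅-sym []≅p)))
... | nothing     = nothing
≅[]? (_ ∷ p)      = nothing

polyRing : AlmostCommutativeRing _ _
polyRing = record
  { Carrier = Poly ; _≈_ = _≅_ ; _+_ = _+P_ ; _*_ = _*P_ ; -_ = negP ; 0# = [] ; 1# = oneP ; 0≟_ = ≅[]?
  ; isAlmostCommutativeRing = record
    { isCommutativeSemiring = IsCommutativeSemiringˡ.isCommutativeSemiring (record
        { +-isCommutativeMonoid = commutativeMonoid +P-cong +P-assoc (λ _ → ≅-refl) +P-identityʳ +P-comm
        ; *-isCommutativeMonoid = commutativeMonoid *P-cong *P-assoc *P-identityˡ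
                                    *P-identityʳ *P-comm
        ; distribʳ = *P-distribʳ
        ; zeroˡ = λ _ → ≅-refl })
    ; -‿cong = negP-cong
    ; -‿*-distribˡ = negP-*P
    ; -‿+-comm = negP-+P } }
  where
  commutativeMonoid : ∀ {_∙_ : Poly → Poly → Poly} {ε}
    → (∀ {p p' r r'} → p ≅ p' → r ≅ r' → (p ∙ r) ≅ (p' ∙ r'))
    → (∀ p r s → ((p ∙ r) ∙ s) ≅ (p ∙ (r ∙ s)))
    → (∀ p → (ε ∙ p) ≅ p) → (∀ p → (p ∙ ε) ≅ p) → (∀ p r → (p ∙ r) ≅ (r ∙ p))
    → IsCommutativeMonoid _≅_ _∙_ ε
  commutativeMonoid cong assoc idˡ idʳ comm = record
    { isMonoid = record
      { isSemigroup = record { isMagma = record { isEquivalence = ≅-isEquivalence ; ∙-cong = cong } ; assoc = assoc }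
      ; identity = idˡ , idʳ }
    ; comm = comm }

infix 4 _≉0
_≉0 : Poly → Set
p ≉0 = ¬ (p ≅ [])

∷*P-lower : ∀ {a} p r → a ≡ + 0 → ((a ∷ p) *P r) ≅ [] → (p *P r) ≅ []
∷*P-lower {a} p r a≡0 e = coeffwise λ i → begin
  coeff (p *P r) i                                  ≡⟨ sym (ℤ.+-identityˡ _) ⟩
  + 0 +ℤ coeff (p *P r) i                           ≡⟨ cong (_+ℤ coeff (p *P r) i) (sym (trans (cong (_*ℤ coeff r (suc i)) a≡0) (ℤ.*-zeroˡ (coeff r (suc i))))) ⟩
  a *ℤ coeff r (suc i) +ℤ coeff (p *P r) i          ≡⟨ sym (coeff-∷*P a p r (suc i)) ⟩
  coeff ((a ∷ p) *P r) (suc i)                      ≡⟨ coeff-≡ e (suc i) ⟩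
  + 0                                               ∎
  where open ≡-Reasoning

*P∷-lower : ∀ p {b r} → b ≡ + 0 → (p *P (b ∷ r)) ≅ [] → (p *P r) ≅ []
*P∷-lower p {b} {r} b≡0 e = ≅-trans (*P-comm p r) (∷*P-lower r p b≡0 (≅-trans (*P-comm (b ∷ r) p) e))

*P-zero-divisor : ∀ p r → (p *P r) ≅ [] → p ≅ [] ⊎ r ≅ []
*P-zero-divisor []      r       _ = inj₁ ≅-refl
*P-zero-divisor (a ∷ p) []      _ = inj₂ ≅-refl
*P-zero-divisor (a ∷ p) (b ∷ r) e =
  [ (λ a≡0 → Sum.map₁ (∷-≅[] a≡0) (*P-zero-divisor p (b ∷ r) (∷*P-lower p (b ∷ r) a≡0 e)))
  , (λ b≡0 → Sum.map₂ (∷-≅[] b≡0) (*P-zero-divisor (a ∷ p) r (*P∷-lower (a ∷ p) b≡0 e))) ]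
  (ℤ.i*j≡0⇒i≡0∨j≡0 a (trans (sym (ℤ.+-identityʳ _)) (coeff-≡ e zero)))

*P-≉0 : ∀ {p r} → p ≉0 → r ≉0 → (p *P r) ≉0
*P-≉0 {p} {r} p≉0 r≉0 pr≅[] with *P-zero-divisor p r pr≅[]
... | inj₁ p≅[] = p≉0 p≅[]
... | inj₂ r≅[] = r≉0 r≅[]

*P-cancelʳ : ∀ {c} p r → c ≉0 → (p *P c) ≅ (r *P c) → p ≅ r
*P-cancelʳ {c} p r c≉0 pc≅rc with *P-zero-divisor (p +P negP r) c difference≅[]
  where
  difference≅[] : ((p +P negP r) *P c) ≅ []
  difference≅[] = begin
    (p +P negP r) *P c               ≈⟨ distrib p r c ⟩
    (p *P c) +P negP (r *P c)        ≈⟨ +P-cong pc≅rc ≅-refl ⟩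
    (r *P c) +P negP (r *P c)        ≈⟨ +P-inverseʳ (r *P c) ⟩
    []                               ∎
    where
    open ≅-Reasoning
    distrib : ∀ p r c → ((p +P negP r) *P c) ≅ ((p *P c) +P negP (r *P c))
    distrib = solve-∀ polyRing
... | inj₂ c≅[] = ⊥-elim (c≉0 c≅[])
... | inj₁ p-r≅[] = ≅-trans (split p r) (+P-congˡ r p-r≅[])
  where
  split : ∀ p r → p ≅ ((p +P negP r) +P r)
  split = solve-∀ polyRing

-- q-integers and powers of q

q : Poly
q = qPow 1

qIntP : ℕ → Poly
qIntP zero    = []
qIntP (suc a) = + 1 ∷ qIntP a

q*P≅∷ : ∀ p → (q *P p) ≅ (+ 0 ∷ p)
q*P≅∷ p = begin
  q *P p                       ≈⟨ +P-congˡ (+ 0 ∷ (oneP *P p)) (scaleP-zero p) ⟩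
  [] +P (+ 0 ∷ (oneP *P p))    ≈⟨ ∷-cong refl (*P-identityˡ p) ⟩
  + 0 ∷ p                      ∎
  where
  open ≅-Reasoning
  scaleP-zero : ∀ p → scaleP (+ 0) p ≅ []
  scaleP-zero p = coeffwise λ i → trans (coeff-scale (+ 0) p i) (ℤ.*-zeroˡ (coeff p i))

qPow-suc : ∀ e → qPow (suc e) ≅ (q *P qPow e)
qPow-suc e = ≅-sym (q*P≅∷ (qPow e))

qIntP-suc : ∀ a → qIntP (suc a) ≅ (oneP +P (q *P qIntP a))
qIntP-suc a = ≅-trans (∷-cong (sym (ℤ.+-identityʳ (+ 1))) ≅-refl) (+P-congʳ oneP (≅-sym (q*P≅∷ (qIntP a))))

qPow-+ : ∀ a b → qPow (a + b) ≅ (qPow a *P qPow b)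
qPow-+ zero    b = ≅-sym (*P-identityˡ (qPow b))
qPow-+ (suc a) b = begin
  qPow (suc (a + b))           ≈⟨ qPow-suc (a + b) ⟩
  q *P qPow (a + b)            ≈⟨ *P-congʳ q (qPow-+ a b) ⟩
  q *P (qPow a *P qPow b)      ≈⟨ ≅-sym (*P-assoc q (qPow a) (qPow b)) ⟩
  (q *P qPow a) *P qPow b      ≈⟨ *P-cong (≅-sym (qPow-suc a)) ≅-refl ⟩
  qPow (suc a) *P qPow b       ∎
  where open ≅-Reasoning

qIntP-+ : ∀ a b → qIntP (a + b) ≅ (qIntP a +P (qPow a *P qIntP b))
qIntP-+ zero    b = ≅-sym (*P-identityˡ (qIntP b))
qIntP-+ (suc a) b = begin
  qIntP (suc (a + b))                                 ≈⟨ qIntP-suc (a + b) ⟩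
  oneP +P (q *P qIntP (a + b))                        ≈⟨ +P-congʳ oneP (*P-congʳ q (qIntP-+ a b)) ⟩
  oneP +P (q *P (qIntP a +P (qPow a *P qIntP b)))     ≈⟨ rearrange q (qIntP a) (qPow a) (qIntP b) ⟩
  (oneP +P (q *P qIntP a)) +P ((q *P qPow a) *P qIntP b) ≈⟨ +P-cong (≅-sym (qIntP-suc a)) (*P-congˡ (qIntP b) (≅-sym (qPow-suc a))) ⟩
  qIntP (suc a) +P (qPow (suc a) *P qIntP b)          ∎
  where
  open ≅-Reasoning
  rearrange : ∀ x u w v → (oneP +P (x *P (u +P (w *P v)))) ≅ ((oneP +P (x *P u)) +P ((x *P w) *P v))
  rearrange = solve-∀ polyRing

qPow≅1-[1-q]qIntP : ∀ a → qPow a ≅ (oneP -P ((oneP -P q) *P qIntP a))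
qPow≅1-[1-q]qIntP zero    = ≅-sym (+P-congʳ oneP (negP-cong (*P-zeroʳ (oneP -P q))))
qPow≅1-[1-q]qIntP (suc a) = begin
  qPow (suc a)                                         ≈⟨ qPow-suc a ⟩
  q *P qPow a                                          ≈⟨ *P-congʳ q (qPow≅1-[1-q]qIntP a) ⟩
  q *P (oneP -P ((oneP -P q) *P qIntP a))              ≈⟨ rearrange q (qIntP a) ⟩
  oneP -P ((oneP -P q) *P (oneP +P (q *P qIntP a)))    ≈⟨ +P-congʳ oneP (negP-cong (*P-congʳ (oneP -P q) (≅-sym (qIntP-suc a)))) ⟩
  oneP -P ((oneP -P q) *P qIntP (suc a))               ∎
  where
  open ≅-Reasoning
  rearrange : ∀ x u → (x *P (oneP -P ((oneP -P x) *P u))) ≅ (oneP -P ((oneP -P x) *P (oneP +P (x *P u))))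
  rearrange = solve-∀ polyRing

1-qPow≅qIntP*[1-q] : ∀ a → (oneP -P qPow a) ≅ (qIntP a *P (oneP -P q))
1-qPow≅qIntP*[1-q] a = ≅-trans (+P-congʳ oneP (negP-cong (qPow≅1-[1-q]qIntP a))) (rearrange q (qIntP a))
  where
  rearrange : ∀ x u → (oneP -P (oneP -P ((oneP -P x) *P u))) ≅ (u *P (oneP -P x))
  rearrange = solve-∀ polyRing

qPow-choose2-suc : ∀ k → qPow (suc k C 2) ≅ (qPow k *P qPow (k C 2))
qPow-choose2-suc k = ≅-trans (≡⇒≅ (cong qPow choose2-suc)) (qPow-+ k (k C 2))
  where
  choose2-suc : suc k C 2 ≡ k + k C 2
  choose2-suc = trans (sym (C.nCk+nC[k+1]≡[n+1]C[k+1] k 1)) (cong (_+ k C 2) (C.nC1≡n k))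

qIntP-sucʳ : ∀ a → qIntP (suc a) ≅ (qIntP a +P qPow a)
qIntP-sucʳ a = begin
  qIntP (suc a)                     ≡⟨ cong qIntP (ℕ.+-comm 1 a) ⟩
  qIntP (a + 1)                     ≈⟨ qIntP-+ a 1 ⟩
  qIntP a +P (qPow a *P qIntP 1)    ≈⟨ +P-congʳ (qIntP a) (*P-identityʳ (qPow a)) ⟩
  qIntP a +P qPow a                 ∎
  where open ≅-Reasoning

qIntP-suc-+ : ∀ j k → qIntP (suc (k + j)) ≅ (qIntP (suc j) +P (qPow (suc j) *P qIntP k))
qIntP-suc-+ j k = ≅-trans (≡⇒≅ (cong (qIntP ∘ suc) (ℕ.+-comm k j))) (qIntP-+ (suc j) k)

qIntP-suc-≉0 : ∀ a → qIntP (suc a) ≉0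
qIntP-suc-≉0 a e with coeff-≡ e zero
... | ()

oneP-≉0 : oneP ≉0
oneP-≉0 e with coeff-≡ e zero
... | ()

1+qⁿ : ℕ → Poly
1+qⁿ n = oneP -P (qPow n *P constP -[1+ 0 ])

pochP : ℕ → Poly
pochP zero    = oneP
pochP (suc n) = pochP n *P 1+qⁿ n

-- Rising q-products and Gaussian binomials

qRise : ℕ → ℕ → Poly
qRise a zero    = oneP
qRise a (suc l) = qRise a l *P qIntP (suc (a + l))

qFactP : ℕ → Poly
qFactP = qRise 0

qRise-front : ∀ a l → qRise a (suc l) ≅ (qIntP (suc a) *P qRise (suc a) l)
qRise-front a zero    = ≅-trans (*P-identityˡ _) (≅-trans (≡⇒≅ (cong (qIntP ∘ suc) (ℕ.+-identityʳ a))) (≅-sym (*P-identityʳ _)))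
qRise-front a (suc l) = begin
  qRise a (suc l) *P qIntP (suc (a + suc l))                 ≈⟨ *P-cong (qRise-front a l) (≡⇒≅ (cong (qIntP ∘ suc) (ℕ.+-suc a l))) ⟩
  (qIntP (suc a) *P qRise (suc a) l) *P qIntP (suc (suc a + l)) ≈⟨ *P-assoc (qIntP (suc a)) (qRise (suc a) l) (qIntP (suc (suc a + l))) ⟩
  qIntP (suc a) *P qRise (suc a) (suc l)                    ∎
  where open ≅-Reasoning

qRise-+ : ∀ a l l' → qRise a (l + l') ≅ (qRise a l *P qRise (a + l) l')
qRise-+ a l zero     = ≅-trans (≡⇒≅ (cong (qRise a) (ℕ.+-identityʳ l))) (≅-sym (*P-identityʳ _))
qRise-+ a l (suc l') = begin
  qRise a (l + suc l')                                          ≡⟨ cong (qRise a) (ℕ.+-suc l l') ⟩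
  qRise a (l + l') *P qIntP (suc (a + (l + l')))                ≈⟨ *P-cong (qRise-+ a l l') (≡⇒≅ (cong (qIntP ∘ suc) (sym (ℕ.+-assoc a l l')))) ⟩
  (qRise a l *P qRise (a + l) l') *P qIntP (suc (a + l + l'))   ≈⟨ *P-assoc (qRise a l) _ _ ⟩
  qRise a l *P qRise (a + l) (suc l')                          ∎
  where open ≅-Reasoning

qRise-≉0 : ∀ a l → qRise a l ≉0
qRise-≉0 a zero    = oneP-≉0
qRise-≉0 a (suc l) = *P-≉0 (qRise-≉0 a l) (qIntP-suc-≉0 (a + l))

-- qBinomP k j is the Gaussian binomial [k+j choose k], indexed by the two parts k and j.
qBinomP : ℕ → ℕ → Poly
qBinomP zero    j       = oneP
qBinomP (suc k) zero    = oneP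
qBinomP (suc k) (suc j) = (qPow (suc j) *P qBinomP k (suc j)) +P qBinomP (suc k) j

qBinomP-factorial : ∀ k j → qFactP (k + j) ≅ (qBinomP k j *P (qFactP k *P qFactP j))
qBinomP-factorial zero    j       = ≅-sym (≅-trans (*P-identityˡ _) (*P-identityˡ _))
qBinomP-factorial (suc k) zero    = begin
  qFactP (suc k + 0)                    ≡⟨ cong qFactP (ℕ.+-identityʳ (suc k)) ⟩
  qFactP (suc k)                        ≈⟨ ≅-sym (≅-trans (*P-identityˡ _) (*P-identityʳ _)) ⟩
  oneP *P (qFactP (suc k) *P oneP)      ∎
  where open ≅-Reasoning
qBinomP-factorial (suc k) (suc j) = begin
  qFactP (k + suc j) *P qIntP (suc (k + suc j))
    ≈⟨ *P-congʳ (qFactP (k + suc j)) (≅-trans (≡⇒≅ (cong qIntP (sum≡ k j))) (qIntP-+ (suc j) (suc k))) ⟩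
  qFactP (k + suc j) *P (qIntP (suc j) +P (qPow (suc j) *P qIntP (suc k)))
    ≈⟨ split (qFactP (k + suc j)) (qFactP (suc k + j)) (qIntP (suc j)) (qPow (suc j)) (qIntP (suc k)) (≡⇒≅ (cong qFactP (ℕ.+-suc k j))) ⟩
  (qFactP (suc k + j) *P qIntP (suc j)) +P ((qPow (suc j) *P qIntP (suc k)) *P qFactP (k + suc j))
    ≈⟨ +P-cong (*P-congˡ (qIntP (suc j)) (qBinomP-factorial (suc k) j))
               (*P-congʳ (qPow (suc j) *P qIntP (suc k)) (qBinomP-factorial k (suc j))) ⟩
  ((Bk+1,j *P (qFactP (suc k) *P qFactP j)) *P qIntP (suc j)) +P ((qPow (suc j) *P qIntP (suc k)) *P (Bk,j+1 *P (qFactP k *P qFactP (suc j))))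
    ≈⟨ regroup Bk+1,j Bk,j+1 (qFactP k) (qFactP j) (qIntP (suc k)) (qIntP (suc j)) (qPow (suc j)) ⟩
  qBinomP (suc k) (suc j) *P (qFactP (suc k) *P qFactP (suc j)) ∎
  where
  open ≅-Reasoning
  Bk+1,j = qBinomP (suc k) j
  Bk,j+1 = qBinomP k (suc j)
  sum≡ : ∀ k j → suc (k + suc j) ≡ suc j + suc k
  sum≡ k j = cong suc (trans (ℕ.+-suc k j) (trans (cong suc (ℕ.+-comm k j)) (sym (ℕ.+-suc j k))))
  split : ∀ f f' a w b → f ≅ f' → (f *P (a +P (w *P b))) ≅ ((f' *P a) +P ((w *P b) *P f))
  split f f' a w b f≅f' = ≅-trans (distrib f a (w *P b)) (+P-congˡ _ (*P-congˡ a f≅f'))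
    where
    distrib : ∀ f a c → (f *P (a +P c)) ≅ ((f *P a) +P (c *P f))
    distrib = solve-∀ polyRing
  regroup : ∀ B B' fk fj ik ij w →
    (((B *P ((fk *P ik) *P fj)) *P ij) +P ((w *P ik) *P (B' *P (fk *P (fj *P ij)))))
      ≅ (((w *P B') +P B) *P ((fk *P ik) *P (fj *P ij)))
  regroup = solve-∀ polyRing

qBinomP-ratio : ∀ k j → (qBinomP k (suc j) *P qIntP (suc j)) ≅ (qBinomP (suc k) j *P qIntP (suc k))
qBinomP-ratio k j = *P-cancelʳ _ _ (*P-≉0 (qRise-≉0 0 k) (qRise-≉0 0 j)) (begin
  (qBinomP k (suc j) *P qIntP (suc j)) *P (qFactP k *P qFactP j)      ≈⟨ regroupʳ (qBinomP k (suc j)) (qIntP (suc j)) (qFactP k) (qFactP j) ⟩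
  qBinomP k (suc j) *P (qFactP k *P qFactP (suc j))                 ≈⟨ ≅-sym (qBinomP-factorial k (suc j)) ⟩
  qFactP (k + suc j)                                                ≡⟨ cong qFactP (ℕ.+-suc k j) ⟩
  qFactP (suc k + j)                                                ≈⟨ qBinomP-factorial (suc k) j ⟩
  qBinomP (suc k) j *P (qFactP (suc k) *P qFactP j)                 ≈⟨ regroupˡ (qBinomP (suc k) j) (qIntP (suc k)) (qFactP k) (qFactP j) ⟩
  (qBinomP (suc k) j *P qIntP (suc k)) *P (qFactP k *P qFactP j)      ∎)
  where
  open ≅-Reasoning
  regroupʳ : ∀ b i f g → ((b *P i) *P (f *P g)) ≅ (b *P (f *P (g *P i)))
  regroupʳ = solve-∀ polyRing
  regroupˡ : ∀ b i f g → (b *P ((f *P i) *P g)) ≅ ((b *P i) *P (f *P g))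
  regroupˡ = solve-∀ polyRing

qBinomP⁻ : ℕ → ℕ → Poly
qBinomP⁻ zero    j = []
qBinomP⁻ (suc k) j = qBinomP k (suc j)

qBinomP-pascal : ∀ k j → qBinomP k (suc j) ≅ ((qPow (suc j) *P qBinomP⁻ k j) +P qBinomP k j)
qBinomP-pascal zero    j = ≅-sym (+P-congˡ oneP (*P-zeroʳ (qPow (suc j))))
qBinomP-pascal (suc k) j = ≅-refl

qBinomP⁻-ratio : ∀ k j → (qBinomP⁻ k j *P qIntP (suc j)) ≅ (qBinomP k j *P qIntP k)
qBinomP⁻-ratio zero    j = ≅-sym (*P-zeroʳ oneP)
qBinomP⁻-ratio (suc k) j = qBinomP-ratio k j

qBinomP-zeroʳ : ∀ k → qBinomP k 0 ≡ oneP
qBinomP-zeroʳ zero    = refl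
qBinomP-zeroʳ (suc k) = refl

-- Identities between q-integers, proved by expansion

open import Tactic.RingSolver.NonReflective polyRing using (Expr; Κ; Ι; _⊕_; _⊗_; _⊛_; ⊝_; _⊜_; module Ops)
open import Algebra.Properties.Semiring.Exp.TCOptimised (AlmostCommutativeRing.semiring polyRing) using (^-congˡ)
open import Algebra.Definitions.RawSemiring (AlmostCommutativeRing.rawSemiring polyRing) using (_^′_)

⟦⟧-cong : ∀ {n} (e : Expr Poly n) {ρ ρ' : Vec Poly n} → Pointwise _≅_ ρ ρ' → Ops.⟦ e ⟧ ρ ≅ Ops.⟦ e ⟧ ρ'
⟦⟧-cong (Κ c)   ρ≅ρ' = ≅-refl
⟦⟧-cong (Ι i)   ρ≅ρ' = Pointwise.lookup ρ≅ρ' i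
⟦⟧-cong (e ⊕ f) ρ≅ρ' = +P-cong (⟦⟧-cong e ρ≅ρ') (⟦⟧-cong f ρ≅ρ')
⟦⟧-cong (e ⊗ f) ρ≅ρ' = *P-cong (⟦⟧-cong e ρ≅ρ') (⟦⟧-cong f ρ≅ρ')
⟦⟧-cong (e ⊛ k) ρ≅ρ' = ^-congˡ k (⟦⟧-cong e ρ≅ρ')
⟦⟧-cong (⊝ e)   ρ≅ρ' = negP-cong (⟦⟧-cong e ρ≅ρ')

_[_]ᴱ : ∀ {k n} → Expr Poly k → Vec (Expr Poly n) k → Expr Poly n
Κ c     [ σ ]ᴱ = Κ c
Ι i     [ σ ]ᴱ = Vec.lookup σ i
(e ⊕ f) [ σ ]ᴱ = e [ σ ]ᴱ ⊕ f [ σ ]ᴱ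
(e ⊗ f) [ σ ]ᴱ = e [ σ ]ᴱ ⊗ f [ σ ]ᴱ
(e ⊛ k) [ σ ]ᴱ = e [ σ ]ᴱ ⊛ k
(⊝ e)   [ σ ]ᴱ = ⊝ e [ σ ]ᴱ

⟦[]ᴱ⟧ : ∀ {k n} (e : Expr Poly k) (σ : Vec (Expr Poly n) k) ρ →
        Ops.⟦ e [ σ ]ᴱ ⟧ ρ ≡ Ops.⟦ e ⟧ (Vec.map (λ s → Ops.⟦ s ⟧ ρ) σ)
⟦[]ᴱ⟧ (Κ c)   σ ρ = refl
⟦[]ᴱ⟧ (Ι i)   σ ρ = sym (Vec.lookup-map i _ σ)
⟦[]ᴱ⟧ (e ⊕ f) σ ρ = cong₂ _+P_ (⟦[]ᴱ⟧ e σ ρ) (⟦[]ᴱ⟧ f σ ρ)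
⟦[]ᴱ⟧ (e ⊗ f) σ ρ = cong₂ _*P_ (⟦[]ᴱ⟧ e σ ρ) (⟦[]ᴱ⟧ f σ ρ)
⟦[]ᴱ⟧ (e ⊛ k) σ ρ = cong (_^′ k) (⟦[]ᴱ⟧ e σ ρ)
⟦[]ᴱ⟧ (⊝ e)   σ ρ = cong negP (⟦[]ᴱ⟧ e σ ρ)

-- Exponents are syntax trees so that their values reproduce, up to definitional equality, the
-- exponents written in a statement.
infixl 6 _⊹_
data Exponent (n : ℕ) : Set where
  var : Fin n → Exponent n
  lit : ℕ → Exponent n
  _⊹_ : Exponent n → Exponent n → Exponent n

data QLeaf (n : ℕ) : Set where
  qInt⟨_⟩ qPow⟨_⟩ : Exponent n → QLeaf n

module Expansion {n : ℕ} (es : Vec ℕ n) where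

  value : Exponent n → ℕ
  value (var i) = Vec.lookup es i
  value (lit c) = c
  value (s ⊹ t) = value s + value t

  leafValue : QLeaf n → Poly
  leafValue qInt⟨ t ⟩ = qIntP (value t)
  leafValue qPow⟨ t ⟩ = qPow (value t)

  atoms : Vec Poly (suc n)
  atoms = q ∷ Vec.map qIntP es

  qᴱ : Expr Poly (suc n)
  qᴱ = Ι Fin.zero

  litIntᴱ litPowᴱ : ℕ → Expr Poly (suc n)
  litIntᴱ zero    = Κ []
  litIntᴱ (suc c) = Κ oneP ⊕ qᴱ ⊗ litIntᴱ c
  litPowᴱ zero    = Κ oneP
  litPowᴱ (suc c) = qᴱ ⊗ litPowᴱ c

  intᴱ powᴱ : Exponent n → Expr Poly (suc n)
  intᴱ (var i) = Ι (Fin.suc i)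
  intᴱ (lit c) = litIntᴱ c
  intᴱ (s ⊹ t) = intᴱ s ⊕ powᴱ s ⊗ intᴱ t
  powᴱ (var i) = Κ oneP ⊕ ⊝ ((Κ oneP ⊕ ⊝ qᴱ) ⊗ Ι (Fin.suc i))
  powᴱ (lit c) = litPowᴱ c
  powᴱ (s ⊹ t) = powᴱ s ⊗ powᴱ t

  expand : QLeaf n → Expr Poly (suc n)
  expand qInt⟨ t ⟩ = intᴱ t
  expand qPow⟨ t ⟩ = powᴱ t

  private
    ⟦_⟧ₐ : Expr Poly (suc n) → Poly
    ⟦ e ⟧ₐ = Ops.⟦ e ⟧ atoms

    atom≅ : ∀ i → qIntP (Vec.lookup es i) ≅ ⟦ Ι (Fin.suc i) ⟧ₐ
    atom≅ i = ≡⇒≅ (sym (Vec.lookup-map i qIntP es))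

    litInt-sound : ∀ c → qIntP c ≅ ⟦ litIntᴱ c ⟧ₐ
    litInt-sound zero    = ≅-refl
    litInt-sound (suc c) = ≅-trans (qIntP-suc c) (+P-congʳ oneP (*P-congʳ q (litInt-sound c)))

    litPow-sound : ∀ c → qPow c ≅ ⟦ litPowᴱ c ⟧ₐ
    litPow-sound zero    = ≅-refl
    litPow-sound (suc c) = ≅-trans (qPow-suc c) (*P-congʳ q (litPow-sound c))

    intᴱ-sound : ∀ t → qIntP (value t) ≅ ⟦ intᴱ t ⟧ₐ
    powᴱ-sound : ∀ t → qPow (value t) ≅ ⟦ powᴱ t ⟧ₐ
    intᴱ-sound (var i) = atom≅ i
    intᴱ-sound (lit c) = litInt-sound c
    intᴱ-sound (s ⊹ t) = ≅-trans (qIntP-+ (value s) (value t)) (+P-cong (intᴱ-sound s) (*P-cong (powᴱ-sound s) (intᴱ-sound t)))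
    powᴱ-sound (var i) = ≅-trans (qPow≅1-[1-q]qIntP _) (+P-congʳ oneP (negP-cong (*P-congʳ (oneP -P q) (atom≅ i))))
    powᴱ-sound (lit c) = litPow-sound c
    powᴱ-sound (s ⊹ t) = ≅-trans (qPow-+ (value s) (value t)) (*P-cong (powᴱ-sound s) (powᴱ-sound t))

    expand-sound : ∀ {k} (leaves : Vec (QLeaf n) k) →
      Pointwise _≅_ (Vec.map leafValue leaves) (Vec.map ⟦_⟧ₐ (Vec.map expand leaves))
    expand-sound []                  = []
    expand-sound (qInt⟨ t ⟩ ∷ leaves) = intᴱ-sound t ∷ expand-sound leaves
    expand-sound (qPow⟨ t ⟩ ∷ leaves) = powᴱ-sound t ∷ expand-sound leaves

  -- An identity between q-integers and powers of q with exponents built from the parameters es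
  -- holds once both sides agree after expanding every leaf, via [s+t] = [s] + qˢ[t] and
  -- qˢ = 1 - (1-q)[s], into a polynomial in q and the [eᵢ].
  byExpansion : ∀ {k} (leaves : Vec (QLeaf n) k) (f : N-ary k (Expr Poly k) (Expr Poly k × Expr Poly k)) →
    let lhs , rhs = Ops.close k f; σ = Vec.map expand leaves in
    Ops.⟦ lhs [ σ ]ᴱ ⇓⟧ atoms ≅ Ops.⟦ rhs [ σ ]ᴱ ⇓⟧ atoms →
    Ops.⟦ lhs ⟧ (Vec.map leafValue leaves) ≅ Ops.⟦ rhs ⟧ (Vec.map leafValue leaves)
  byExpansion {k} leaves f normal-forms≅ = begin
    Ops.⟦ lhs ⟧ (Vec.map leafValue leaves)  ≈⟨ ⟦⟧-cong lhs (expand-sound leaves) ⟩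
    Ops.⟦ lhs ⟧ (Vec.map ⟦_⟧ₐ σ)            ≡⟨ sym (⟦[]ᴱ⟧ lhs σ atoms) ⟩
    ⟦ lhs [ σ ]ᴱ ⟧ₐ                          ≈⟨ ≅-sym (Ops.correct (lhs [ σ ]ᴱ) atoms) ⟩
    Ops.⟦ lhs [ σ ]ᴱ ⇓⟧ atoms               ≈⟨ normal-forms≅ ⟩
    Ops.⟦ rhs [ σ ]ᴱ ⇓⟧ atoms               ≈⟨ Ops.correct (rhs [ σ ]ᴱ) atoms ⟩
    ⟦ rhs [ σ ]ᴱ ⟧ₐ                          ≡⟨ ⟦[]ᴱ⟧ rhs σ atoms ⟩
    Ops.⟦ rhs ⟧ (Vec.map ⟦_⟧ₐ σ)            ≈⟨ ⟦⟧-cong rhs (Pointwise.sym ≅-sym (expand-sound leaves)) ⟩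
    Ops.⟦ rhs ⟧ (Vec.map leafValue leaves)  ∎
    where
    open ≅-Reasoning
    lhs = proj₁ (Ops.close k f)
    rhs = proj₂ (Ops.close k f)
    σ = Vec.map expand leaves

module _ (c j : ℕ) where
  open Expansion (c ∷ j ∷ [])
  private
    c' j' : Exponent 2
    c' = var Fin.zero
    j' = var (Fin.suc Fin.zero)

  qIntP-cross-difference : ((qIntP (suc c + (1 + (j + j))) *P qIntP (suc c)) -P (qIntP c *P qIntP (suc c + suc j)))
    ≅ (qIntP (suc j) *P (qPow c +P (qPow (suc c + j) *P qIntP (suc c))))
  qIntP-cross-difference = byExpansion
    (qInt⟨ (lit 1 ⊹ c') ⊹ (lit 1 ⊹ (j' ⊹ j')) ⟩ ∷ qInt⟨ lit 1 ⊹ c' ⟩ ∷ qInt⟨ c' ⟩ ∷ qInt⟨ (lit 1 ⊹ c') ⊹ (lit 1 ⊹ j') ⟩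
     ∷ qInt⟨ lit 1 ⊹ j' ⟩ ∷ qPow⟨ c' ⟩ ∷ qPow⟨ (lit 1 ⊹ c') ⊹ j' ⟩ ∷ [])
    (λ c+2j+2 c+1 c c+j+2 j+1 q^c q^c+j+1 →
      c+2j+2 ⊗ c+1 ⊕ ⊝ (c ⊗ c+j+2) ⊜ j+1 ⊗ (q^c ⊕ q^c+j+1 ⊗ c+1))
    ≅-refl

module _ (n a c : ℕ) where
  open Expansion (n ∷ a ∷ c ∷ [])
  private
    n' a' c' : Exponent 3
    n' = var Fin.zero
    a' = var (Fin.suc Fin.zero)
    c' = var (Fin.suc (Fin.suc Fin.zero))

  qIntP-shifted-difference : ((qIntP (suc n + a) *P (qPow c +P (qPow n *P qIntP (suc c)))) -P ((qPow n *P qIntP (suc c + 1)) *P qIntP a))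
    ≅ (qIntP (suc n) *P (qPow c +P (qPow (a + n) *P qIntP (suc c))))
  qIntP-shifted-difference = byExpansion
    (qInt⟨ (lit 1 ⊹ n') ⊹ a' ⟩ ∷ qPow⟨ c' ⟩ ∷ qPow⟨ n' ⟩ ∷ qInt⟨ lit 1 ⊹ c' ⟩ ∷ qInt⟨ (lit 1 ⊹ c') ⊹ lit 1 ⟩ ∷ qInt⟨ a' ⟩
     ∷ qInt⟨ lit 1 ⊹ n' ⟩ ∷ qPow⟨ a' ⊹ n' ⟩ ∷ [])
    (λ n+1+a q^c q^n c+1 c+2 a n+1 q^a+n →
      n+1+a ⊗ (q^c ⊕ q^n ⊗ c+1) ⊕ ⊝ (q^n ⊗ c+2 ⊗ a) ⊜ n+1 ⊗ (q^c ⊕ q^a+n ⊗ c+1))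
    ≅-refl

-- Finite sums and fractions

sumP : ℕ → (ℕ → Poly) → Poly
sumP zero    f = f zero
sumP (suc n) f = sumP n f +P f (suc n)

sumP-*P : ∀ c n f → (c *P sumP n f) ≅ sumP n (λ k → c *P f k)
sumP-*P c zero    f = ≅-refl
sumP-*P c (suc n) f = ≅-trans (distrib c (sumP n f) (f (suc n))) (+P-congˡ (c *P f (suc n)) (sumP-*P c n f))
  where
  distrib : ∀ c x y → (c *P (x +P y)) ≅ ((c *P x) +P (c *P y))
  distrib = solve-∀ polyRing

sumP-telescope : ∀ n (A B W : ℕ → Poly) → (∀ k → k ≤ n → A k ≅ (B k +P (W k -P W (suc k)))) →
                 sumP n A ≅ (sumP n B +P (W 0 -P W (suc n)))
sumP-telescope zero    A B W A≅ = A≅ 0 z≤n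
sumP-telescope (suc n) A B W A≅ = begin
  sumP n A +P A (suc n)
    ≈⟨ +P-cong (sumP-telescope n A B W (λ k k≤n → A≅ k (ℕ.m≤n⇒m≤1+n k≤n))) (A≅ (suc n) ℕ.≤-refl) ⟩
  (sumP n B +P (W 0 -P W (suc n))) +P (B (suc n) +P (W (suc n) -P W (suc (suc n))))
    ≈⟨ collapse (sumP n B) (B (suc n)) (W 0) (W (suc n)) (W (suc (suc n))) ⟩
  (sumP n B +P B (suc n)) +P (W 0 -P W (suc (suc n))) ∎
  where
  open ≅-Reasoning
  collapse : ∀ s b w₀ w w′ → ((s +P (w₀ -P w)) +P (b +P (w -P w′))) ≅ ((s +P b) +P (w₀ -P w′))
  collapse = solve-∀ polyRing

infix 4 _≅F_
record _≅F_ (x y : Frac) : Set where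
  constructor cross
  field cross-≅ : (num x *P den y) ≅ (num y *P den x)

≅F⇒≃F : ∀ {x y} → x ≅F y → x ≃F y
≅F⇒≃F {x} {y} (cross x≅y) = all-zero (≅-trans (+P-congˡ (negP (num y *P den x)) x≅y) (+P-inverseʳ (num y *P den x)))
  where
  all-zero : ∀ {p} → p ≅ [] → All (_≡ + 0) p
  all-zero {[]}    _   = []
  all-zero {a ∷ p} p≅[] = coeff-≡ p≅[] 0 ∷ all-zero (coeffwise λ i → coeff-≡ p≅[] (suc i))

≅F-sym : ∀ {x y} → x ≅F y → y ≅F x
≅F-sym (cross x≅y) = cross (≅-sym x≅y)

-- A fraction with zero denominator is ≅F to every fraction, hence the hypothesis on y.
≅F-trans : ∀ {x} y {z} → den y ≉0 → x ≅F y → y ≅F z → x ≅F z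
≅F-trans {x} y {z} y≉0 (cross x≅y) (cross y≅z) = cross (*P-cancelʳ (num x *P den z) (num z *P den x) y≉0 (begin
  (num x *P den z) *P den y    ≈⟨ swap (num x) (den z) (den y) ⟩
  (num x *P den y) *P den z    ≈⟨ *P-congˡ (den z) x≅y ⟩
  (num y *P den x) *P den z    ≈⟨ swap (num y) (den x) (den z) ⟩
  (num y *P den z) *P den x    ≈⟨ *P-congˡ (den x) y≅z ⟩
  (num z *P den y) *P den x    ≈⟨ swap (num z) (den y) (den x) ⟩
  (num z *P den x) *P den y    ∎))
  where
  open ≅-Reasoning
  swap : ∀ a b c → ((a *P b) *P c) ≅ ((a *P c) *P b)
  swap = solve-∀ polyRing

*F-cong : ∀ {x x′ y y′} → x ≅F x′ → y ≅F y′ → (x *F y) ≅F (x′ *F y′)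
*F-cong {x} {x′} {y} {y′} (cross x≅) (cross y≅) = cross (≅-trans (interchange (num x) (num y) (den x′) (den y′))
  (≅-trans (*P-cong x≅ y≅) (interchange (num x′) (den x) (num y′) (den y))))
  where
  interchange : ∀ a b c d → ((a *P b) *P (c *P d)) ≅ ((a *P c) *P (b *P d))
  interchange = solve-∀ polyRing

/F-cong : ∀ {x x′ y y′} → x ≅F x′ → y ≅F y′ → (x /F y) ≅F (x′ /F y′)
/F-cong {x} {x′} {y} {y′} (cross x≅) (cross y≅) = cross (≅-trans (regroup₁ (num x) (den y) (den x′) (num y′))
  (≅-trans (*P-cong x≅ (≅-sym y≅)) (regroup₂ (num x′) (den x) (num y) (den y′))))
  where
  regroup₁ : ∀ a b c d → ((a *P b) *P (c *P d)) ≅ ((a *P c) *P (d *P b))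
  regroup₁ = solve-∀ polyRing
  regroup₂ : ∀ a b c d → ((a *P b) *P (c *P d)) ≅ ((a *P d) *P (b *P c))
  regroup₂ = solve-∀ polyRing

+F-cong : ∀ {x x′ y y′} → x ≅F x′ → y ≅F y′ → (x +F y) ≅F (x′ +F y′)
+F-cong {x} {x′} {y} {y′} (cross x≅) (cross y≅) = cross (begin
  ((num x *P den y) +P (num y *P den x)) *P (den x′ *P den y′)
    ≈⟨ expand (num x) (den y) (num y) (den x) (den x′) (den y′) ⟩
  ((num x *P den x′) *P (den y *P den y′)) +P ((num y *P den y′) *P (den x *P den x′))
    ≈⟨ +P-cong (*P-congˡ (den y *P den y′) x≅) (*P-congˡ (den x *P den x′) y≅) ⟩
  ((num x′ *P den x) *P (den y *P den y′)) +P ((num y′ *P den y) *P (den x *P den x′))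
    ≈⟨ collect (num x′) (den x) (den y) (den y′) (num y′) (den x′) ⟩
  ((num x′ *P den y′) +P (num y′ *P den x′)) *P (den x *P den y) ∎)
  where
  open ≅-Reasoning
  expand : ∀ a b c d e f → (((a *P b) +P (c *P d)) *P (e *P f)) ≅ (((a *P e) *P (b *P f)) +P ((c *P f) *P (d *P e)))
  expand = solve-∀ polyRing
  collect : ∀ a d b f c e → (((a *P d) *P (b *P f)) +P ((c *P b) *P (d *P e))) ≅ (((a *P f) +P (c *P e)) *P (d *P b))
  collect = solve-∀ polyRing

≅F-refl : ∀ {x} → x ≅F x
≅F-refl = cross ≅-refl

polyF-*F : ∀ p r → (polyF p *F polyF r) ≅F polyF (p *P r)
polyF-*F p r = cross (*P-congʳ (p *P r) (*P-identityˡ oneP))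

qInt≅F : ∀ a → qInt a ≅F polyF (qIntP a)
qInt≅F a = cross (≅-trans (*P-identityʳ (oneP -P qPow a)) (1-qPow≅qIntP*[1-q] a))

qFact≅F : ∀ a → qFact a ≅F polyF (qFactP a)
qFact≅F zero    = ≅F-refl
qFact≅F (suc a) = ≅F-trans (polyF (qFactP a) *F polyF (qIntP (suc a))) (*P-≉0 oneP-≉0 oneP-≉0) (*F-cong (qFact≅F a) (qInt≅F (suc a))) (polyF-*F (qFactP a) (qIntP (suc a)))

qBinom≅F : ∀ {n k} → k ≤ n → qBinom n k ≅F polyF (qBinomP k (n ∸ k))
qBinom≅F {n} {k} k≤n = ≅F-trans (polyF (qFactP n) /F (polyF (qFactP k) *F polyF (qFactP (n ∸ k)))) (*P-≉0 oneP-≉0 (*P-≉0 (qRise-≉0 0 k) (qRise-≉0 0 (n ∸ k))))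
  (/F-cong (qFact≅F n) (*F-cong (qFact≅F k) (qFact≅F (n ∸ k))))
  (cross (begin
    (qFactP n *P (oneP *P oneP)) *P oneP                          ≈⟨ drop-ones (qFactP n) ⟩
    qFactP n                                                      ≡⟨ cong qFactP (sym (ℕ.m+[n∸m]≡n k≤n)) ⟩
    qFactP (k + (n ∸ k))                                          ≈⟨ qBinomP-factorial k (n ∸ k) ⟩
    qBinomP k (n ∸ k) *P (qFactP k *P qFactP (n ∸ k))             ≈⟨ ≅-sym (*P-congʳ (qBinomP k (n ∸ k)) (*P-identityˡ _)) ⟩
    qBinomP k (n ∸ k) *P (oneP *P (qFactP k *P qFactP (n ∸ k)))   ∎))
  where
  open ≅-Reasoning
  drop-ones : ∀ f → ((f *P (oneP *P oneP)) *P oneP) ≅ f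
  drop-ones = solve-∀ polyRing

qPoch≅F : ∀ n → qPoch (constP -[1+ 0 ]) n ≅F polyF (pochP n)
qPoch≅F zero    = ≅F-refl
qPoch≅F (suc n) = ≅F-trans (polyF (pochP n) *F polyF (1+qⁿ n)) (*P-≉0 oneP-≉0 oneP-≉0) (*F-cong (qPoch≅F n) (≅F-refl {polyF (1+qⁿ n)})) (polyF-*F (pochP n) (1+qⁿ n))

sumF≅F : ∀ n f g d → d ≉0 → (∀ k → k ≤ n → f k ≅F (g k // d)) → sumF n f ≅F (sumP n g // d)
sumF≅F zero    f g d d≉0 f≅ = f≅ 0 z≤n
sumF≅F (suc n) f g d d≉0 f≅ = ≅F-trans ((sumP n g // d) +F (g (suc n) // d)) (*P-≉0 d≉0 d≉0)
  (+F-cong (sumF≅F n f g d d≉0 (λ k k≤n → f≅ k (ℕ.m≤n⇒m≤1+n k≤n))) (f≅ (suc n) ℕ.≤-refl))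
  (cross (common-denominator (sumP n g) (g (suc n)) d))
  where
  common-denominator : ∀ s t d → (((s *P d) +P (t *P d)) *P d) ≅ ((s +P t) *P (d *P d))
  common-denominator = solve-∀ polyRing

-- Throughout, m = suc M.  numerator n k j is the k-th summand of the theorem times the common
-- denominator [m][m+1]⋯[m+2n], where j stands for n ∸ k; certificate is its WZ mate.
module WZ (M : ℕ) where

  numerator : ℕ → ℕ → ℕ → Poly
  numerator n k j = ((qBinomP k j *P qPow (k C 2)) *P qIntP (suc M + 2 * k)) *P (qRise M k *P qRise (suc M + n + k) j)

  certificate : ℕ → ℕ → ℕ → Poly
  certificate n k j = (((qPow j *P qBinomP k j) *P qPow (suc k C 2)) *P qIntP (suc M + 2 * k + 1))
                      *P (qRise M (suc k) *P qRise (suc (suc M + n + k)) (suc j))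

  certificate⁻ : ℕ → ℕ → ℕ → Poly
  certificate⁻ n zero    j = []
  certificate⁻ n (suc k) j = certificate n k (suc j)

  growth : ℕ → Poly
  growth n = 1+qⁿ n *P (qIntP (suc M + 1 + 2 * n) *P qIntP (suc M + 2 * suc n))

  module Step (k j : ℕ) where

    n c : ℕ
    n = k + j
    c = M + 2 * k

    [m+2n+1] [m+2n+2] [M+2k] [m+2k] [m+2k+1] [m+n+k+1] [m+k] G Z : Poly
    [m+2n+1]  = qIntP (suc M + 1 + 2 * n)
    [m+2n+2]  = qIntP (suc M + 2 * suc n)
    [M+2k]    = qIntP c
    [m+2k]    = qIntP (suc c)
    [m+2k+1]  = qIntP (suc c + 1)
    [m+n+k+1] = qIntP (suc (suc M + n + k))
    [m+k]     = qIntP (suc (M + k))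
    G = qPow c +P (qPow (suc c + j) *P [m+2k])
    -- the factor shared by all four terms of the WZ relation
    Z = ((qPow (k C 2) *P qRise M k) *P qRise (suc (suc M + n + k)) j) *P [m+2n+2]

    qBinomP⁻-coefficient : (([m+2n+1] *P [m+2k]) -P ([M+2k] *P [m+n+k+1])) ≅ (qIntP (suc j) *P G)
    qBinomP⁻-coefficient = subst₂ (λ x y → ((qIntP x *P [m+2k]) -P ([M+2k] *P qIntP y)) ≅ (qIntP (suc j) *P G))
                                  (exponent₁ M k j) (exponent₂ M k j) (qIntP-cross-difference c j)
      where
      exponent₁ : ∀ M k j → suc (M + 2 * k) + (1 + (j + j)) ≡ suc M + 1 + 2 * (k + j)
      exponent₁ = ℕ-Solver.solve-∀
      exponent₂ : ∀ M k j → suc (M + 2 * k) + suc j ≡ suc (suc M + (k + j) + k)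
      exponent₂ = ℕ-Solver.solve-∀

    shifted : (([m+n+k+1] *P (qPow c +P (qPow n *P [m+2k]))) -P ((qPow n *P [m+2k+1]) *P [m+k])) ≅ (qIntP (suc n) *P G)
    shifted = subst₂ (λ x y → ((qIntP x *P (qPow c +P (qPow n *P [m+2k]))) -P ((qPow n *P [m+2k+1]) *P [m+k]))
                               ≅ (qIntP (suc n) *P (qPow c +P (qPow y *P [m+2k]))))
                     (exponent₁ M k j) (exponent₂ M k j) (qIntP-shifted-difference n (suc (M + k)) c)
      where
      exponent₁ : ∀ M k j → suc (k + j) + suc (M + k) ≡ suc (suc M + (k + j) + k)
      exponent₁ = ℕ-Solver.solve-∀
      exponent₂ : ∀ M k j → suc (M + k) + (k + j) ≡ suc (M + 2 * k) + j
      exponent₂ = ℕ-Solver.solve-∀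

    qBinomP-coefficient :
      ((([m+2n+1] *P [m+2k]) -P ((1+qⁿ n *P [m+2k]) *P [m+n+k+1])) +P (((qPow j *P qPow k) *P [m+2k+1]) *P [m+k]))
      ≅ negP ((qPow (suc j) *P qIntP k) *P G)
    qBinomP-coefficient = begin
      (([m+2n+1] *P [m+2k]) -P ((1+qⁿ n *P [m+2k]) *P [m+n+k+1])) +P (((qPow j *P qPow k) *P [m+2k+1]) *P [m+k])
        ≈⟨ +P-congʳ (([m+2n+1] *P [m+2k]) -P ((1+qⁿ n *P [m+2k]) *P [m+n+k+1])) (*P-congˡ [m+k] (*P-congˡ [m+2k+1] q^j*q^k≅q^n)) ⟩
      (([m+2n+1] *P [m+2k]) -P ((1+qⁿ n *P [m+2k]) *P [m+n+k+1])) +P ((qPow n *P [m+2k+1]) *P [m+k])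
        ≈⟨ isolate [m+2n+1] [M+2k] [m+2k] [m+n+k+1] [m+2k+1] [m+k] (qPow n) ⟩
      (([m+2n+1] *P [m+2k]) -P ([M+2k] *P [m+n+k+1])) +P (([m+n+k+1] *P ([M+2k] -P (1+qⁿ n *P [m+2k]))) +P ((qPow n *P [m+2k+1]) *P [m+k]))
        ≈⟨ +P-cong qBinomP⁻-coefficient (+P-congˡ ((qPow n *P [m+2k+1]) *P [m+k]) (*P-congʳ [m+n+k+1] (+P-congˡ (negP (1+qⁿ n *P [m+2k])) [M+2k]≅[m+2k]-qᶜ))) ⟩
      (qIntP (suc j) *P G) +P (([m+n+k+1] *P (([m+2k] -P qPow c) -P (1+qⁿ n *P [m+2k]))) +P ((qPow n *P [m+2k+1]) *P [m+k]))
        ≈⟨ regroup (qIntP (suc j)) G [m+n+k+1] [m+2k] (qPow c) (qPow n) [m+2k+1] [m+k] ⟩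
      (qIntP (suc j) *P G) -P (([m+n+k+1] *P (qPow c +P (qPow n *P [m+2k]))) -P ((qPow n *P [m+2k+1]) *P [m+k]))
        ≈⟨ +P-congʳ (qIntP (suc j) *P G) (negP-cong (≅-trans shifted (*P-congˡ G (qIntP-suc-+ j k)))) ⟩
      (qIntP (suc j) *P G) -P ((qIntP (suc j) +P (qPow (suc j) *P qIntP k)) *P G)
        ≈⟨ cancel (qIntP (suc j)) G (qPow (suc j)) (qIntP k) ⟩
      negP ((qPow (suc j) *P qIntP k) *P G) ∎
      where
      open ≅-Reasoning
      q^j*q^k≅q^n : (qPow j *P qPow k) ≅ qPow n
      q^j*q^k≅q^n = ≅-sym (≅-trans (≡⇒≅ (cong qPow (ℕ.+-comm k j))) (qPow-+ j k))
      [M+2k]≅[m+2k]-qᶜ : [M+2k] ≅ ([m+2k] -P qPow c)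
      [M+2k]≅[m+2k]-qᶜ = ≅-trans (add-sub [M+2k] (qPow c)) (+P-congˡ (negP (qPow c)) (≅-sym (qIntP-sucʳ c)))
        where
        add-sub : ∀ x y → x ≅ ((x +P y) -P y)
        add-sub = solve-∀ polyRing
      isolate : ∀ a c₀ c₁ d e b qn →
        (((a *P c₁) -P (((oneP -P (qn *P constP -[1+ 0 ])) *P c₁) *P d)) +P ((qn *P e) *P b))
        ≅ (((a *P c₁) -P (c₀ *P d)) +P ((d *P (c₀ -P ((oneP -P (qn *P constP -[1+ 0 ])) *P c₁))) +P ((qn *P e) *P b)))
      isolate = solve-∀ polyRing
      regroup : ∀ jp g d c₁ qc qn e b →
        ((jp *P g) +P ((d *P ((c₁ -P qc) -P ((oneP -P (qn *P constP -[1+ 0 ])) *P c₁))) +P ((qn *P e) *P b)))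
        ≅ ((jp *P g) -P ((d *P (qc +P (qn *P c₁))) -P ((qn *P e) *P b)))
      regroup = solve-∀ polyRing
      cancel : ∀ jp g q k → ((jp *P g) -P ((jp +P (q *P k)) *P g)) ≅ negP ((q *P k) *P g)
      cancel = solve-∀ polyRing

    wz-coefficients :
      ([m+2n+1] *P (qBinomP k (suc j) *P [m+2k]))
      ≅ ((((1+qⁿ n *P [m+2k]) *P [m+n+k+1]) *P qBinomP k j)
         +P ((((qPow (suc j) *P qBinomP⁻ k j) *P [M+2k]) *P [m+n+k+1])
             -P ((((qPow j *P qPow k) *P qBinomP k j) *P [m+2k+1]) *P [m+k])))
    wz-coefficients = begin
      [m+2n+1] *P (B′ *P [m+2k])
        ≈⟨ *P-congʳ [m+2n+1] (*P-congˡ [m+2k] (qBinomP-pascal k j)) ⟩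
      [m+2n+1] *P (((qPow (suc j) *P B⁻) +P B) *P [m+2k])
        ≈⟨ separate [m+2n+1] [M+2k] [m+2k] [m+n+k+1] [m+2k+1] [m+k] (qPow (suc j)) (qPow j *P qPow k) B⁻ B (qPow n) ⟩
      (((qPow (suc j) *P B⁻) *P (([m+2n+1] *P [m+2k]) -P ([M+2k] *P [m+n+k+1])))
        +P (B *P ((([m+2n+1] *P [m+2k]) -P ((1+qⁿ n *P [m+2k]) *P [m+n+k+1])) +P (((qPow j *P qPow k) *P [m+2k+1]) *P [m+k])))) +P rhs
        ≈⟨ +P-congˡ rhs (+P-cong (*P-congʳ (qPow (suc j) *P B⁻) qBinomP⁻-coefficient) (*P-congʳ B qBinomP-coefficient)) ⟩
      (((qPow (suc j) *P B⁻) *P (qIntP (suc j) *P G)) +P (B *P negP ((qPow (suc j) *P qIntP k) *P G))) +P rhs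
        ≈⟨ +P-congˡ rhs (factor (qPow (suc j)) B⁻ (qIntP (suc j)) G B (qIntP k)) ⟩
      ((qPow (suc j) *P G) *P ((B⁻ *P qIntP (suc j)) -P (B *P qIntP k))) +P rhs
        ≈⟨ +P-congˡ rhs (*P-congʳ (qPow (suc j) *P G) (+P-congˡ (negP (B *P qIntP k)) (qBinomP⁻-ratio k j))) ⟩
      ((qPow (suc j) *P G) *P ((B *P qIntP k) -P (B *P qIntP k))) +P rhs
        ≈⟨ vanish (qPow (suc j) *P G) (B *P qIntP k) rhs ⟩
      rhs ∎
      where
      open ≅-Reasoning
      B  = qBinomP k j
      B′ = qBinomP k (suc j)
      B⁻ = qBinomP⁻ k j
      rhs = (((1+qⁿ n *P [m+2k]) *P [m+n+k+1]) *P B)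
            +P ((((qPow (suc j) *P B⁻) *P [M+2k]) *P [m+n+k+1]) -P ((((qPow j *P qPow k) *P B) *P [m+2k+1]) *P [m+k]))
      separate : ∀ a c₀ c₁ d e b′ q₁ qjk b⁻ b qn →
        (a *P (((q₁ *P b⁻) +P b) *P c₁))
        ≅ ((((q₁ *P b⁻) *P ((a *P c₁) -P (c₀ *P d)))
            +P (b *P (((a *P c₁) -P (((oneP -P (qn *P constP -[1+ 0 ])) *P c₁) *P d)) +P ((qjk *P e) *P b′))))
           +P (((((oneP -P (qn *P constP -[1+ 0 ])) *P c₁) *P d) *P b)
               +P ((((q₁ *P b⁻) *P c₀) *P d) -P ((((qjk *P b) *P e) *P b′)))))
      separate = solve-∀ polyRing
      factor : ∀ q₁ b⁻ jp g b k → (((q₁ *P b⁻) *P (jp *P g)) +P (b *P negP ((q₁ *P k) *P g))) ≅ ((q₁ *P g) *P ((b⁻ *P jp) -P (b *P k)))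
      factor = solve-∀ polyRing
      vanish : ∀ x y r → ((x *P (y -P y)) +P r) ≅ r
      vanish = solve-∀ polyRing

    numerator-factor : numerator (suc n) k (suc j) ≅ ((qBinomP k (suc j) *P [m+2k]) *P Z)
    numerator-factor = ≅-trans
      (≡⇒≅ (cong₂ (λ b t → ((qBinomP k (suc j) *P qPow (k C 2)) *P [m+2k]) *P (qRise M k *P (qRise b j *P qIntP t)))
                  (base≡ M k j) (top≡ M k j)))
      (shuffle (qBinomP k (suc j)) (qPow (k C 2)) [m+2k] (qRise M k) (qRise (suc (suc M + n + k)) j) [m+2n+2])
      where
      base≡ : ∀ M k j → suc M + suc (k + j) + k ≡ suc (suc M + (k + j) + k)
      base≡ = ℕ-Solver.solve-∀
      top≡ : ∀ M k j → suc (suc M + suc (k + j) + k + j) ≡ suc M + 2 * suc (k + j)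
      top≡ = ℕ-Solver.solve-∀
      shuffle : ∀ b c a r s t → (((b *P c) *P a) *P (r *P (s *P t))) ≅ ((b *P a) *P (((c *P r) *P s) *P t))
      shuffle = solve-∀ polyRing

    growth-factor : (growth n *P numerator n k j) ≅ ((((1+qⁿ n *P [m+2k]) *P [m+n+k+1]) *P qBinomP k j) *P Z)
    growth-factor = begin
      growth n *P numerator n k j
        ≈⟨ shuffle₁ (1+qⁿ n) [m+2n+1] [m+2n+2] (qBinomP k j) (qPow (k C 2)) [m+2k] (qRise M k) R₀ ⟩
      ((1+qⁿ n *P [m+2k]) *P qBinomP k j) *P (((qPow (k C 2) *P qRise M k) *P (R₀ *P [m+2n+1])) *P [m+2n+2])
        ≈⟨ *P-congʳ ((1+qⁿ n *P [m+2k]) *P qBinomP k j) (*P-congˡ [m+2n+2] (*P-congʳ (qPow (k C 2) *P qRise M k) peel)) ⟩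
      ((1+qⁿ n *P [m+2k]) *P qBinomP k j) *P (((qPow (k C 2) *P qRise M k) *P ([m+n+k+1] *P R₁)) *P [m+2n+2])
        ≈⟨ shuffle₂ (1+qⁿ n *P [m+2k]) (qBinomP k j) (qPow (k C 2) *P qRise M k) [m+n+k+1] R₁ [m+2n+2] ⟩
      (((1+qⁿ n *P [m+2k]) *P [m+n+k+1]) *P qBinomP k j) *P Z ∎
      where
      open ≅-Reasoning
      R₀ = qRise (suc M + n + k) j
      R₁ = qRise (suc (suc M + n + k)) j
      peel : (R₀ *P [m+2n+1]) ≅ ([m+n+k+1] *P R₁)
      peel = ≅-trans (≡⇒≅ (cong (λ e → R₀ *P qIntP e) (sym (top≡ M k j)))) (qRise-front (suc M + n + k) j)
        where
        top≡ : ∀ M k j → suc (suc M + (k + j) + k + j) ≡ suc M + 1 + 2 * (k + j)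
        top≡ = ℕ-Solver.solve-∀
      shuffle₁ : ∀ p a t b c c₁ r r₀ → ((p *P (a *P t)) *P (((b *P c) *P c₁) *P (r *P r₀)))
                                       ≅ (((p *P c₁) *P b) *P (((c *P r) *P (r₀ *P a)) *P t))
      shuffle₁ = solve-∀ polyRing
      shuffle₂ : ∀ x b z d r t → ((x *P b) *P ((z *P (d *P r)) *P t)) ≅ (((x *P d) *P b) *P ((z *P r) *P t))
      shuffle₂ = solve-∀ polyRing

    certificate-factor : certificate n k j ≅ (((((qPow j *P qPow k) *P qBinomP k j) *P [m+2k+1]) *P [m+k]) *P Z)
    certificate-factor = begin
      certificate n k j
        ≡⟨ cong (λ t → (((qPow j *P B) *P qPow (suc k C 2)) *P [m+2k+1]) *P ((qRise M k *P [m+k]) *P (R₁ *P qIntP t))) (top≡ M k j) ⟩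
      (((qPow j *P B) *P qPow (suc k C 2)) *P [m+2k+1]) *P ((qRise M k *P [m+k]) *P (R₁ *P [m+2n+2]))
        ≈⟨ *P-congˡ ((qRise M k *P [m+k]) *P (R₁ *P [m+2n+2])) (*P-congˡ [m+2k+1] (*P-congʳ (qPow j *P B) (qPow-choose2-suc k))) ⟩
      (((qPow j *P B) *P (qPow k *P qPow (k C 2))) *P [m+2k+1]) *P ((qRise M k *P [m+k]) *P (R₁ *P [m+2n+2]))
        ≈⟨ shuffle (qPow j) B (qPow k) (qPow (k C 2)) [m+2k+1] (qRise M k) [m+k] R₁ [m+2n+2] ⟩
      ((((qPow j *P qPow k) *P B) *P [m+2k+1]) *P [m+k]) *P Z ∎
      where
      open ≅-Reasoning
      B  = qBinomP k j
      R₁ = qRise (suc (suc M + n + k)) j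
      top≡ : ∀ M k j → suc (suc (suc M + (k + j) + k) + j) ≡ suc M + 2 * suc (k + j)
      top≡ = ℕ-Solver.solve-∀
      shuffle : ∀ qj b qk c e r a r₁ t → ((((qj *P b) *P (qk *P c)) *P e) *P ((r *P a) *P (r₁ *P t)))
                                        ≅ (((((qj *P qk) *P b) *P e) *P a) *P (((c *P r) *P r₁) *P t))
      shuffle = solve-∀ polyRing

  certificate⁻-factor : ∀ k j → let open Step k j in
    certificate⁻ n k j ≅ ((((qPow (suc j) *P qBinomP⁻ k j) *P [M+2k]) *P [m+n+k+1]) *P Z)
  certificate⁻-factor zero    j = ≅-sym (annihilate (qPow (suc j)) [M+2k] [m+n+k+1] Z)
    where
    open Step zero j
    annihilate : ∀ a b c z → ((((a *P []) *P b) *P c) *P z) ≅ []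
    annihilate = solve-∀ polyRing
  certificate⁻-factor (suc k) j = begin
    L *P (qRise M (suc k) *P (qRise b (suc j) *P qIntP (suc (b + suc j))))
      ≈⟨ *P-congʳ L (*P-congʳ (qRise M (suc k)) (*P-congˡ (qIntP (suc (b + suc j))) (qRise-front b j))) ⟩
    L *P (qRise M (suc k) *P ((qIntP (suc b) *P qRise (suc b) j) *P qIntP (suc (b + suc j))))
      ≡⟨ cong₂ (λ e x → (((qPow (suc j) *P B⁻) *P qPow (suc k C 2)) *P qIntP e) *P (qRise M (suc k) *P ((qIntP x *P qRise x j) *P qIntP (suc (b + suc j)))))
               (M+2k≡ M k) (base≡ M k j) ⟩
    (((qPow (suc j) *P B⁻) *P qPow (suc k C 2)) *P [M+2k]) *P (qRise M (suc k) *P (([m+n+k+1] *P qRise (suc (suc M + n + suc k)) j) *P qIntP (suc (b + suc j))))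
      ≡⟨ cong (λ t → (((qPow (suc j) *P B⁻) *P qPow (suc k C 2)) *P [M+2k]) *P (qRise M (suc k) *P (([m+n+k+1] *P qRise (suc (suc M + n + suc k)) j) *P qIntP t)))
              (top≡ M k j) ⟩
    (((qPow (suc j) *P B⁻) *P qPow (suc k C 2)) *P [M+2k]) *P (qRise M (suc k) *P (([m+n+k+1] *P qRise (suc (suc M + n + suc k)) j) *P [m+2n+2]))
      ≈⟨ shuffle (qPow (suc j) *P B⁻) (qPow (suc k C 2)) [M+2k] (qRise M (suc k)) [m+n+k+1] (qRise (suc (suc M + n + suc k)) j) [m+2n+2] ⟩
    (((qPow (suc j) *P B⁻) *P [M+2k]) *P [m+n+k+1]) *P Z ∎
    where
    open ≅-Reasoning
    open Step (suc k) j
    B⁻ = qBinomP k (suc j)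
    b  = suc (suc M + n + k)
    L  = ((qPow (suc j) *P B⁻) *P qPow (suc k C 2)) *P qIntP (suc M + 2 * k + 1)
    M+2k≡ : ∀ M k → suc M + 2 * k + 1 ≡ M + 2 * suc k
    M+2k≡ = ℕ-Solver.solve-∀
    base≡ : ∀ M k j → suc (suc (suc M + (suc k + j) + k)) ≡ suc (suc M + (suc k + j) + suc k)
    base≡ = ℕ-Solver.solve-∀
    top≡ : ∀ M k j → suc (suc (suc M + (suc k + j) + k) + suc j) ≡ suc M + 2 * suc (suc k + j)
    top≡ = ℕ-Solver.solve-∀
    shuffle : ∀ a c e r d r₁ t → (((a *P c) *P e) *P (r *P ((d *P r₁) *P t))) ≅ (((a *P e) *P d) *P (((c *P r) *P r₁) *P t))
    shuffle = solve-∀ polyRing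

  wz-step : ∀ k j → let open Step k j in
    ([m+2n+1] *P numerator (suc n) k (suc j)) ≅ ((growth n *P numerator n k j) +P (certificate⁻ n k j -P certificate n k j))
  wz-step k j = begin
    [m+2n+1] *P numerator (suc n) k (suc j)                     ≈⟨ *P-congʳ [m+2n+1] numerator-factor ⟩
    [m+2n+1] *P ((qBinomP k (suc j) *P [m+2k]) *P Z)            ≈⟨ ≅-sym (*P-assoc [m+2n+1] (qBinomP k (suc j) *P [m+2k]) Z) ⟩
    ([m+2n+1] *P (qBinomP k (suc j) *P [m+2k])) *P Z            ≈⟨ *P-congˡ Z wz-coefficients ⟩
    (cB +P (cW -P cU)) *P Z                                     ≈⟨ distribute cB cW cU Z ⟩
    (cB *P Z) +P ((cW *P Z) -P (cU *P Z))                       ≈⟨ ≅-sym (+P-cong growth-factor (+P-cong (certificate⁻-factor k j) (negP-cong certificate-factor))) ⟩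
    (growth n *P numerator n k j) +P (certificate⁻ n k j -P certificate n k j) ∎
    where
    open ≅-Reasoning
    open Step k j
    cB = ((1+qⁿ n *P [m+2k]) *P [m+n+k+1]) *P qBinomP k j
    cW = ((qPow (suc j) *P qBinomP⁻ k j) *P [M+2k]) *P [m+n+k+1]
    cU = (((qPow j *P qPow k) *P qBinomP k j) *P [m+2k+1]) *P [m+k]
    distribute : ∀ b w u z → ((b +P (w -P u)) *P z) ≅ ((b *P z) +P ((w *P z) -P (u *P z)))
    distribute = solve-∀ polyRing

  numeratorAt : ℕ → ℕ → Poly
  numeratorAt n k = numerator n k (n ∸ k)

  numeratorSum : ℕ → Poly
  numeratorSum n = sumP n (numeratorAt n)

  certificateBelow : ℕ → ℕ → Poly
  certificateBelow n zero    = []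
  certificateBelow n (suc k) = certificate n k (n ∸ k)

  telescoping-step : ∀ n k → k ≤ n →
    (qIntP (suc M + 1 + 2 * n) *P numeratorAt (suc n) k)
    ≅ ((growth n *P numeratorAt n k) +P (certificateBelow n k -P certificateBelow n (suc k)))
  telescoping-step n k k≤n = begin
    [m+2n+1] *P numerator (suc n) k (suc n ∸ k)
      ≡⟨ cong (λ j → [m+2n+1] *P numerator (suc n) k j) (ℕ.+-∸-assoc 1 k≤n) ⟩
    [m+2n+1] *P numerator (suc n) k (suc (n ∸ k))
      ≈⟨ subst (λ n′ → (qIntP (suc M + 1 + 2 * n′) *P numerator (suc n′) k (suc (n ∸ k)))
                       ≅ ((growth n′ *P numerator n′ k (n ∸ k)) +P (certificate⁻ n′ k (n ∸ k) -P certificate n′ k (n ∸ k))))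
               (ℕ.m+[n∸m]≡n k≤n) (wz-step k (n ∸ k)) ⟩
    (growth n *P numeratorAt n k) +P (certificate⁻ n k (n ∸ k) -P certificate n k (n ∸ k))
      ≡⟨ cong (λ w → (growth n *P numeratorAt n k) +P (w -P certificate n k (n ∸ k))) (certificate⁻≡certificateBelow k≤n) ⟩
    (growth n *P numeratorAt n k) +P (certificateBelow n k -P certificateBelow n (suc k)) ∎
    where
    open ≅-Reasoning
    [m+2n+1] = qIntP (suc M + 1 + 2 * n)
    certificate⁻≡certificateBelow : ∀ {n k} → k ≤ n → certificate⁻ n k (n ∸ k) ≡ certificateBelow n k
    certificate⁻≡certificateBelow {n}     {zero}  _         = refl
    certificate⁻≡certificateBelow {suc n} {suc k} (s≤s k≤n) = cong (certificate (suc n) k) (sym (ℕ.+-∸-assoc 1 k≤n))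

  last-summand : ∀ n → (qIntP (suc M + 1 + 2 * n) *P numeratorAt (suc n) (suc n)) ≅ certificateBelow n (suc n)
  last-summand n = begin
    [m+2n+1] *P numerator (suc n) (suc n) (n ∸ n)
      ≡⟨ cong (λ j → [m+2n+1] *P numerator (suc n) (suc n) j) (ℕ.n∸n≡0 n) ⟩
    [m+2n+1] *P (((oneP *P c) *P [m+2n+2]) *P (r *P oneP))
      ≈⟨ rearrange [m+2n+1] c [m+2n+2] r ⟩
    (((oneP *P oneP) *P c) *P [m+2n+1]) *P (r *P (oneP *P [m+2n+2]))
      ≡⟨ cong₂ (λ e t → (((oneP *P oneP) *P c) *P qIntP e) *P (r *P (oneP *P qIntP t))) (sym (odd≡ M n)) (sym (even≡ M n)) ⟩
    (((oneP *P oneP) *P c) *P qIntP (suc M + 2 * n + 1)) *P (r *P qRise (suc (suc M + n + n)) 1)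
      ≡⟨ cong (λ b → (((oneP *P b) *P c) *P qIntP (suc M + 2 * n + 1)) *P (r *P qRise (suc (suc M + n + n)) 1)) (sym (qBinomP-zeroʳ n)) ⟩
    certificate n n 0
      ≡⟨ cong (certificate n n) (sym (ℕ.n∸n≡0 n)) ⟩
    certificateBelow n (suc n) ∎
    where
    open ≅-Reasoning
    [m+2n+1] = qIntP (suc M + 1 + 2 * n)
    [m+2n+2] = qIntP (suc M + 2 * suc n)
    c = qPow (suc n C 2)
    r = qRise M (suc n)
    rearrange : ∀ a c t r → (a *P (((oneP *P c) *P t) *P (r *P oneP))) ≅ ((((oneP *P oneP) *P c) *P a) *P (r *P (oneP *P t)))
    rearrange = solve-∀ polyRing
    odd≡ : ∀ M n → suc M + 2 * n + 1 ≡ suc M + 1 + 2 * n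
    odd≡ = ℕ-Solver.solve-∀
    even≡ : ∀ M n → suc (suc (suc M + n + n) + 0) ≡ suc M + 2 * suc n
    even≡ = ℕ-Solver.solve-∀

  numeratorSum-recursion : ∀ n → (qIntP (suc M + 1 + 2 * n) *P numeratorSum (suc n)) ≅ (growth n *P numeratorSum n)
  numeratorSum-recursion n = begin
    [m+2n+1] *P numeratorSum (suc n)                                          ≈⟨ sumP-*P [m+2n+1] (suc n) (numeratorAt (suc n)) ⟩
    sumP n (λ k → [m+2n+1] *P numeratorAt (suc n) k) +P ([m+2n+1] *P numeratorAt (suc n) (suc n))
                                                                              ≈⟨ +P-cong telescoped (last-summand n) ⟩
    (sumP n (λ k → growth n *P numeratorAt n k) +P ([] -P U)) +P U            ≈⟨ cancel (sumP n (λ k → growth n *P numeratorAt n k)) U ⟩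
    sumP n (λ k → growth n *P numeratorAt n k)                                ≈⟨ ≅-sym (sumP-*P (growth n) n (numeratorAt n)) ⟩
    growth n *P numeratorSum n                                                ∎
    where
    open ≅-Reasoning
    [m+2n+1] = qIntP (suc M + 1 + 2 * n)
    U = certificateBelow n (suc n)
    telescoped = sumP-telescope n (λ k → [m+2n+1] *P numeratorAt (suc n) k) (λ k → growth n *P numeratorAt n k)
                                (certificateBelow n) (telescoping-step n)
    cancel : ∀ s u → ((s +P ([] -P u)) +P u) ≅ s
    cancel = solve-∀ polyRing

  evenP : ℕ → Poly
  evenP zero    = qIntP (suc M + 2 * 0)
  evenP (suc n) = evenP n *P qIntP (suc M + 2 * suc n)

  oddP : ℕ → Poly
  oddP zero    = oneP
  oddP (suc n) = oddP n *P qIntP (suc M + 1 + 2 * n)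

  denominator : ℕ → Poly
  denominator n = qRise M (suc (2 * n))

  numeratorSum≅pochP*evenP : ∀ n → numeratorSum n ≅ (pochP n *P evenP n)
  numeratorSum≅pochP*evenP zero    = initial (qIntP (suc M + 2 * 0))
    where
    initial : ∀ e → (((oneP *P oneP) *P e) *P (oneP *P oneP)) ≅ (oneP *P e)
    initial = solve-∀ polyRing
  numeratorSum≅pochP*evenP (suc n) =
    *P-cancelʳ (numeratorSum (suc n)) (pochP (suc n) *P evenP (suc n)) (qIntP-suc-≉0 (M + 1 + 2 * n)) (begin
      numeratorSum (suc n) *P [m+2n+1]                            ≈⟨ *P-comm (numeratorSum (suc n)) [m+2n+1] ⟩
      [m+2n+1] *P numeratorSum (suc n)                            ≈⟨ numeratorSum-recursion n ⟩
      growth n *P numeratorSum n                                  ≈⟨ *P-congʳ (growth n) (numeratorSum≅pochP*evenP n) ⟩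
      (1+qⁿ n *P ([m+2n+1] *P [m+2n+2])) *P (pochP n *P evenP n)  ≈⟨ regroup (1+qⁿ n) [m+2n+1] [m+2n+2] (pochP n) (evenP n) ⟩
      (pochP (suc n) *P evenP (suc n)) *P [m+2n+1]                ∎)
    where
    open ≅-Reasoning
    [m+2n+1] = qIntP (suc M + 1 + 2 * n)
    [m+2n+2] = qIntP (suc M + 2 * suc n)
    regroup : ∀ p a t x y → ((p *P (a *P t)) *P (x *P y)) ≅ (((x *P p) *P (y *P t)) *P a)
    regroup = solve-∀ polyRing

  denominator≅evenP*oddP : ∀ n → denominator n ≅ (evenP n *P oddP n)
  denominator≅evenP*oddP zero    = ≅-trans (*P-identityˡ (qIntP (suc (M + 0)))) (≅-sym (*P-identityʳ (qIntP (suc M + 2 * 0))))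
  denominator≅evenP*oddP (suc n) = begin
    qRise M (suc (2 * suc n))                   ≡⟨ cong (qRise M) (length≡ n) ⟩
    qRise M (suc (2 * n) + 2)                   ≈⟨ qRise-+ M (suc (2 * n)) 2 ⟩
    denominator n *P ((oneP *P qIntP (suc (M + suc (2 * n) + 0))) *P qIntP (suc (M + suc (2 * n) + 1)))
                                                ≡⟨ cong₂ (λ a b → denominator n *P ((oneP *P qIntP a) *P qIntP b)) (odd≡ M n) (even≡ M n) ⟩
    denominator n *P ((oneP *P O) *P E)         ≈⟨ *P-congˡ ((oneP *P O) *P E) (denominator≅evenP*oddP n) ⟩
    (evenP n *P oddP n) *P ((oneP *P O) *P E)   ≈⟨ regroup (evenP n) (oddP n) O E ⟩
    evenP (suc n) *P oddP (suc n)               ∎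
    where
    open ≅-Reasoning
    O = qIntP (suc M + 1 + 2 * n)
    E = qIntP (suc M + 2 * suc n)
    length≡ : ∀ n → suc (2 * suc n) ≡ suc (2 * n) + 2
    length≡ = ℕ-Solver.solve-∀
    odd≡ : ∀ M n → suc (M + suc (2 * n) + 0) ≡ suc M + 1 + 2 * n
    odd≡ = ℕ-Solver.solve-∀
    even≡ : ∀ M n → suc (M + suc (2 * n) + 1) ≡ suc M + 2 * suc n
    even≡ = ℕ-Solver.solve-∀
    regroup : ∀ e o a b → ((e *P o) *P ((oneP *P a) *P b)) ≅ ((e *P b) *P (o *P a))
    regroup = solve-∀ polyRing

2n+1-split : ∀ {n k} → k ≤ n → suc (2 * n) ≡ suc (n + k) + (n ∸ k)
2n+1-split {n} {k} k≤n = cong suc (begin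
  2 * n             ≡⟨ cong (_+_ n) (ℕ.+-identityʳ n) ⟩
  n + n             ≡⟨ cong (_+_ n) (sym (ℕ.m+[n∸m]≡n k≤n)) ⟩
  n + (k + (n ∸ k)) ≡⟨ sym (ℕ.+-assoc n k (n ∸ k)) ⟩
  n + k + (n ∸ k)   ∎)
  where open ≡-Reasoning

module Evaluation (M : ℕ) where
  open WZ M

  summand≅F : ∀ n k → k ≤ n →
    (((qBinom n k *F polyF (qPow (k C 2))) *F qInt (suc M + 2 * k)) *F (qFact (suc M + k ∸ 1) /F qFact (suc M + n + k)))
    ≅F (numeratorAt n k // denominator n)
  summand≅F n k k≤n = ≅F-trans polynomial-parts (*P-≉0 (*P-≉0 (*P-≉0 oneP-≉0 oneP-≉0) oneP-≉0) (*P-≉0 oneP-≉0 (qRise-≉0 0 (suc M + n + k))))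
    (*F-cong (*F-cong (*F-cong (qBinom≅F k≤n) ≅F-refl) (qInt≅F (suc M + 2 * k))) (/F-cong (qFact≅F (M + k)) (qFact≅F (suc M + n + k))))
    (cross (begin
      (coefficient *P (qFactP (M + k) *P oneP)) *P denominator n
        ≈⟨ *P-cong (*P-congʳ coefficient (*P-congˡ oneP (qRise-+ 0 M k))) denominator-split ⟩
      (coefficient *P ((qFactP M *P qRise M k) *P oneP)) *P (qRise M (suc (n + k)) *P qRise (suc M + n + k) (n ∸ k))
        ≈⟨ regroup coefficient (qFactP M) (qRise M k) (qRise M (suc (n + k))) (qRise (suc M + n + k) (n ∸ k)) ⟩
      numeratorAt n k *P (((oneP *P oneP) *P oneP) *P (oneP *P (qFactP M *P qRise M (suc (n + k)))))
        ≈⟨ *P-congʳ (numeratorAt n k) (*P-congʳ ((oneP *P oneP) *P oneP) (*P-congʳ oneP (≅-sym factorial-split))) ⟩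
      numeratorAt n k *P (((oneP *P oneP) *P oneP) *P (oneP *P qFactP (suc M + n + k))) ∎))
    where
    open ≅-Reasoning
    coefficient = (qBinomP k (n ∸ k) *P qPow (k C 2)) *P qIntP (suc M + 2 * k)
    polynomial-parts = ((polyF (qBinomP k (n ∸ k)) *F polyF (qPow (k C 2))) *F polyF (qIntP (suc M + 2 * k)))
                       *F (polyF (qFactP (M + k)) /F polyF (qFactP (suc M + n + k)))
    base≡ : ∀ M n k → M + suc (n + k) ≡ suc M + n + k
    base≡ = ℕ-Solver.solve-∀
    denominator-split : denominator n ≅ (qRise M (suc (n + k)) *P qRise (suc M + n + k) (n ∸ k))
    denominator-split = begin
      qRise M (suc (2 * n))                                    ≡⟨ cong (qRise M) (2n+1-split k≤n) ⟩
      qRise M (suc (n + k) + (n ∸ k))                          ≈⟨ qRise-+ M (suc (n + k)) (n ∸ k) ⟩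
      qRise M (suc (n + k)) *P qRise (M + suc (n + k)) (n ∸ k) ≡⟨ cong (λ b → qRise M (suc (n + k)) *P qRise b (n ∸ k)) (base≡ M n k) ⟩
      qRise M (suc (n + k)) *P qRise (suc M + n + k) (n ∸ k)   ∎
    factorial-split : qFactP (suc M + n + k) ≅ (qFactP M *P qRise M (suc (n + k)))
    factorial-split = ≅-trans (≡⇒≅ (cong qFactP (sym (base≡ M n k)))) (qRise-+ 0 M (suc (n + k)))
    regroup : ∀ c f r r′ r″ → ((c *P ((f *P r) *P oneP)) *P (r′ *P r″))
                              ≅ ((c *P (r *P r″)) *P (((oneP *P oneP) *P oneP) *P (oneP *P (f *P r′))))
    regroup = solve-∀ polyRing

  oddP-≉0 : ∀ n → oddP n ≉0
  oddP-≉0 zero    = oneP-≉0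
  oddP-≉0 (suc n) = *P-≉0 (oddP-≉0 n) (qIntP-suc-≉0 (M + 1 + 2 * n))

  oddProd≅F : ∀ n → oddProd (suc M) n ≅F polyF (oddP n)
  oddProd≅F zero    = ≅F-refl
  oddProd≅F (suc n) = ≅F-trans (polyF (oddP n) *F polyF (qIntP (suc M + 1 + 2 * n))) (*P-≉0 oneP-≉0 oneP-≉0)
    (*F-cong (oddProd≅F n) (qInt≅F (suc M + 1 + 2 * n))) (polyF-*F (oddP n) (qIntP (suc M + 1 + 2 * n)))

  numeratorSum/denominator≅pochP/oddP : ∀ n → (numeratorSum n // denominator n) ≅F (pochP n // oddP n)
  numeratorSum/denominator≅pochP/oddP n = cross (begin
    numeratorSum n *P oddP n          ≈⟨ *P-congˡ (oddP n) (numeratorSum≅pochP*evenP n) ⟩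
    (pochP n *P evenP n) *P oddP n    ≈⟨ *P-assoc (pochP n) (evenP n) (oddP n) ⟩
    pochP n *P (evenP n *P oddP n)    ≈⟨ *P-congʳ (pochP n) (≅-sym (denominator≅evenP*oddP n)) ⟩
    pochP n *P denominator n          ∎)
    where open ≅-Reasoning

  rhs≅F : ∀ n → (qPoch (constP -[1+ 0 ]) n /F oddProd (suc M) n) ≅F (pochP n // oddP n)
  rhs≅F n = ≅F-trans (polyF (pochP n) /F polyF (oddP n)) (*P-≉0 oneP-≉0 (oddP-≉0 n))
    (/F-cong (qPoch≅F n) (oddProd≅F n)) (cross (drop-one (pochP n) (oddP n)))
    where
    drop-one : ∀ p o → ((p *P oneP) *P o) ≅ (p *P (oneP *P o))
    drop-one = solve-∀ polyRing

mainTheorem15 : (m n : ℕ) → 0 < m →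
    sumF n (λ k → ((qBinom n k *F polyF (qPow (k C 2))) *F qInt (m + 2 * k))
                    *F (qFact (m + k ∸ 1) /F qFact (m + n + k)))
      ≃F (qPoch (constP -[1+ 0 ]) n /F oddProd m n)
mainTheorem15 (suc M) n _ = ≅F⇒≃F (
  ≅F-trans (numeratorSum n // denominator n) denominator≉0
    (sumF≅F n _ (numeratorAt n) (denominator n) denominator≉0 (summand≅F n))
  (≅F-trans (pochP n // oddP n) (oddP-≉0 n)
    (numeratorSum/denominator≅pochP/oddP n)
    (≅F-sym (rhs≅F n))))
  where
  open WZ M
  open Evaluation M
  denominator≉0 = qRise-≉0 M (suc (2 * n))
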